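{- For an integer $k\ge2$, let $\mathcal{G}_k$ denote the set of all simple graphs on $k$ vertices with no isolated vertices. If $2\le n\le m$, then \[ \max_{F\in\mathcal{G}_n,\ G\in\mathcal{G}_m}\mathcal{RH}(F,G)=\begin{cases}\frac{m}{2}-1 & n=2,\\[2pt] \frac{m^2}{2m+1}-1 & n\ge3,\ m\ge4.\end{cases}\]
   Context: For a graph $H$ without isolated vertices, $\Delta(H)$ is its maximum degree, $f_H(k)=|\{v: d(v)\ge k\}|$ for integers $k\ge1$, and the smooth ccdh is the piecewise-linear interpolation $\varphi_H(x)=(1-(x-\lfloor x\rfloor))f_H(\lfloor x\rfloor)+(x-\lfloor x\rfloor)f_H(\lfloor x\rfloor+1)$ for real $x\ge1$. The smooth directional Relative Hausdorff distance $\mathcal{RH}_r(F,G)$ is the minimum $\epsilon\ge0$ such that for every integer $d\in\{1,\dots,\Delta(F)\}$ there is a real $d'\in[1,\Delta(G)+1]$ with $|d-d'|\le\epsilon d$ and $|\varphi_F(d)-\varphi_G(d')|\le\epsilon\varphi_F(d)$; and $\mathcal{RH}(F,G)=\max\{\mathcal{RH}_r(F,G),\mathcal{RH}_r(G,F)\}$.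
   Formalization: The tolerance ε and the witness d′ in the smooth directional distance $\mathcal{RH}_r(F,G)$ take values in ℚ rather than the reals. -}

module Defs where

open import Data.Bool using (Bool; true; false; if_then_else_)
open import Data.Nat as ℕ using (ℕ; zero; suc; _⊔_; _≤ᵇ_)
open import Data.Integer as ℤ using (ℤ; +_)
open import Data.Fin using (Fin)
open import Data.List using (List; map; foldr; allFin)
open import Data.Nat.ListAction using (sum)
open import Relation.Nullary using (¬_)
open import Data.Rational as ℚ using (ℚ; _/_; floor; ∣_∣; _≤_; _<_; _+_; _-_; _*_; 0ℚ; 1ℚ)
open import Data.Product using (Σ; ∃; _×_)
open import Relation.Binary.PropositionalEquality using (_≡_)

record Graph (k : ℕ) : Set where
  field
    adj    : Fin k → Fin k → Bool
    sym    : ∀ i j → adj i j ≡ adj j i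
    irrefl : ∀ i → adj i i ≡ false
open Graph public

ℕ→ℚ : ℕ → ℚ
ℕ→ℚ n = + n / 1

deg : ∀ {k} → Graph k → Fin k → ℕ
deg {k} H i = sum (map (λ j → if adj H i j then 1 else 0) (allFin k))

NoIsolated : ∀ {k} → Graph k → Set
NoIsolated {k} H = ∀ i → 1 ℕ.≤ deg H i

Δ : ∀ {k} → Graph k → ℕ
Δ {k} H = foldr _⊔_ 0 (map (deg H) (allFin k))

-- f_H(t) = |{v : d(v) ≥ t}|
ccdh : ∀ {k} → Graph k → ℕ → ℕ
ccdh {k} H t = sum (map (λ i → if t ≤ᵇ deg H i then 1 else 0) (allFin k))

-- smooth ccdh φ_H(x) (intended for x ≥ 1)
φ : ∀ {k} → Graph k → ℚ → ℚ
φ H x = (1ℚ - θ) * ℕ→ℚ (ccdh H j) + θ * ℕ→ℚ (ccdh H (suc j))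
  where
    j : ℕ
    j = ℤ.∣ floor x ∣
    θ : ℚ
    θ = x - ℕ→ℚ j

-- ε is admissible in the definition of the directional distance RH_r(F,G)
-- (so RH_r(F,G) ≤ ε iff RHrAdmissible F G ε, as RH_r is a minimum).
RHrAdmissible : ∀ {n m} → Graph n → Graph m → ℚ → Set
RHrAdmissible F G ε =
  0ℚ ≤ ε ×
  (∀ (d : ℕ) → 1 ℕ.≤ d → d ℕ.≤ Δ F →
     ∃ λ (d' : ℚ) →
       1ℚ ≤ d' × d' ≤ ℕ→ℚ (suc (Δ G)) ×
       ∣ ℕ→ℚ d - d' ∣ ≤ ε * ℕ→ℚ d ×
       ∣ φ F (ℕ→ℚ d) - φ G d' ∣ ≤ ε * φ F (ℕ→ℚ d))

RHLe : ∀ {n m} → Graph n → Graph m → ℚ → Set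
RHLe F G ε = RHrAdmissible F G ε × RHrAdmissible G F ε

MaxRHIs : ℕ → ℕ → ℚ → Set
MaxRHIs n m v =
  (∀ (F : Graph n) (G : Graph m) → NoIsolated F → NoIsolated G → RHLe F G v) ×
  (Σ (Graph n) λ F → Σ (Graph m) λ G → NoIsolated F × NoIsolated G ×
     RHLe F G v × (∀ ε → ε < v → ¬ (RHLe F G ε)))

module Submission where

-- Write p = f_F(d). Since φ_G decreases piecewise linearly from φ_G(1) = |V(G)| to φ_G(Δ(G) + 1) = 0,
-- either p ≥ |V(G)| and d' = 1 matches d, or φ_G takes the value p at some x in [1, Δ(G) + 1]. Then
-- d' = x works if x ≤ (1 + ε) d, and otherwise d' = (1 + ε) d works, because there
-- p ≤ φ_G(d') ≤ min (|V(G)|, |V(G)| (Δ(G) + 1 - d')). As Δ < |V| ≤ m, what remains are polynomial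
-- inequalities in m, valid for ε = m/2 - 1 when n = 2 and for ε = m²/(2m+1) - 1 when n ≥ 3; the latter
-- solves m (m - 2 (1 + ε)) = 1 + ε, the case d = 2, p = 1.
-- Both values are attained by a star F against the complete graph K_m, whose φ equals m up to m - 1 and
-- then drops linearly to 0: at d = 1 (n = 2), resp. d = 2 (n ≥ 3), every d' is either too far from d
-- or has φ_{K_m}(d') too far from φ_F(d).

module RelativeHausdorff where

  open import Data.Bool using (Bool; true; false; if_then_else_; T)
  open import Data.Empty using (⊥; ⊥-elim)
  open import Data.Fin as Fin using (Fin)
  open import Data.Integer as ℤ using (+_; -[1+_])
  import Data.Integer.Properties as ℤₚ
  open import Data.List using (List; []; _∷_; map; foldr; allFin; length)
  open import Data.List.Membership.Propositional using (_∈_)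
  open import Data.List.Membership.Propositional.Properties using (∈-allFin)
  import Data.List.Properties as Listₚ
  open import Data.List.Relation.Unary.Any using (here; there)
  open import Data.Nat as ℕ using (ℕ; zero; suc; z≤n; s≤s; _⊔_; _≤ᵇ_)
  import Data.Nat.Coprimality as Coprime
  import Data.Nat.DivMod as ℕ
  open import Data.Nat.ListAction using (sum)
  import Data.Nat.Properties as ℕₚ
  open import Data.Product using (∃; ∃-syntax; _×_; _,_; proj₁; proj₂)
  open import Data.Rational as ℚ using (ℚ; mkℚ; _+_; _*_; _-_; -_; 0ℚ; 1ℚ; _≤_; _<_; ∣_∣; _/_; *≤*; *<*)
  import Data.Rational.Properties as ℚₚ
  open import Data.Rational.Solver using (module +-*-Solver)
  import Data.Rational.Unnormalised as ℚᵘ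
  import Data.Rational.Unnormalised.Properties as ℚᵘₚ
  open import Data.Sum using (_⊎_; inj₁; inj₂)
  open import Relation.Binary.Core using (_Preserves_⟶_)
  open import Relation.Binary.PropositionalEquality hiding (J)
  open import Relation.Nullary using (¬_; Dec; yes; no)
  open import Relation.Nullary.Decidable using (True; toWitness)

  open import Defs hiding (sym)

  open +-*-Solver

  ℕ→ℚ≡mkℚ : ∀ n → ℕ→ℚ n ≡ mkℚ (+ n) 0 (Coprime.sym (Coprime.1-coprimeTo n))
  ℕ→ℚ≡mkℚ n = ℚₚ.↥p/↧p≡p (mkℚ (+ n) 0 (Coprime.sym (Coprime.1-coprimeTo n)))

  ℕ→ℚ-+ : ∀ a b → ℕ→ℚ (a ℕ.+ b) ≡ ℕ→ℚ a + ℕ→ℚ b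
  ℕ→ℚ-+ a b rewrite ℕ→ℚ≡mkℚ a | ℕ→ℚ≡mkℚ b =
    ℚₚ./-cong (trans (ℤₚ.pos-+ a b) (sym (cong₂ ℤ._+_ (ℤₚ.*-identityʳ (+ a)) (ℤₚ.*-identityʳ (+ b))))) refl

  ℕ→ℚ-* : ∀ a b → ℕ→ℚ (a ℕ.* b) ≡ ℕ→ℚ a * ℕ→ℚ b
  ℕ→ℚ-* a b rewrite ℕ→ℚ≡mkℚ a | ℕ→ℚ≡mkℚ b = ℚₚ./-cong (ℤₚ.pos-* a b) refl

  ℕ→ℚ-suc : ∀ n → ℕ→ℚ (suc n) ≡ 1ℚ + ℕ→ℚ n
  ℕ→ℚ-suc = ℕ→ℚ-+ 1

  ℕ→ℚ-split : ∀ {k n} → k ℕ.≤ n → ℕ→ℚ n ≡ ℕ→ℚ k + ℕ→ℚ (n ℕ.∸ k)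
  ℕ→ℚ-split {k} {n} k≤n = trans (cong ℕ→ℚ (sym (ℕₚ.m+[n∸m]≡n k≤n))) (ℕ→ℚ-+ k (n ℕ.∸ k))

  ℕ→ℚ-∸ : ∀ {k n} → k ℕ.≤ n → ℕ→ℚ (n ℕ.∸ k) ≡ ℕ→ℚ n - ℕ→ℚ k
  ℕ→ℚ-∸ {k} {n} k≤n = trans (solve 2 (λ k r → r := (k :+ r) :- k) refl (ℕ→ℚ k) (ℕ→ℚ (n ℕ.∸ k)))
                             (cong (_- ℕ→ℚ k) (sym (ℕ→ℚ-split k≤n)))

  ℕ→ℚ-mono-≤ : ∀ {a b} → a ℕ.≤ b → ℕ→ℚ a ≤ ℕ→ℚ b
  ℕ→ℚ-mono-≤ {a} {b} a≤b rewrite ℕ→ℚ≡mkℚ a | ℕ→ℚ≡mkℚ b =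
    *≤* (subst₂ ℤ._≤_ (sym (ℤₚ.*-identityʳ (+ a))) (sym (ℤₚ.*-identityʳ (+ b))) (ℤ.+≤+ a≤b))

  ℕ→ℚ-mono-< : ∀ {a b} → a ℕ.< b → ℕ→ℚ a < ℕ→ℚ b
  ℕ→ℚ-mono-< {a} {b} a<b rewrite ℕ→ℚ≡mkℚ a | ℕ→ℚ≡mkℚ b =
    *<* (subst₂ ℤ._<_ (sym (ℤₚ.*-identityʳ (+ a))) (sym (ℤₚ.*-identityʳ (+ b))) (ℤ.+<+ a<b))

  ℕ→ℚ-cancel-< : ∀ {a b} → ℕ→ℚ a < ℕ→ℚ b → a ℕ.< b
  ℕ→ℚ-cancel-< {a} {b} a<b rewrite ℕ→ℚ≡mkℚ a | ℕ→ℚ≡mkℚ b with a<b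
  ... | *<* p with subst₂ ℤ._<_ (ℤₚ.*-identityʳ (+ a)) (ℤₚ.*-identityʳ (+ b)) p
  ...   | ℤ.+<+ q = q

  0≤ℕ→ℚ : ∀ n → 0ℚ ≤ ℕ→ℚ n
  0≤ℕ→ℚ n = ℕ→ℚ-mono-≤ {0} {n} z≤n

  0<ℕ→ℚ-suc : ∀ n → 0ℚ < ℕ→ℚ (suc n)
  0<ℕ→ℚ-suc n = ℕ→ℚ-mono-< {0} {suc n} (s≤s z≤n)

  /-*-cancel : ∀ a b → (+ a / suc b) * ℕ→ℚ (suc b) ≡ ℕ→ℚ a
  /-*-cancel a b = ℚₚ.toℚᵘ-injective (begin
      ℚ.toℚᵘ ((+ a / suc b) * ℕ→ℚ (suc b))
    ≈⟨ ℚₚ.toℚᵘ-homo-* (+ a / suc b) (ℕ→ℚ (suc b)) ⟩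
      ℚ.toℚᵘ (+ a / suc b) ℚᵘ.* ℚ.toℚᵘ (ℕ→ℚ (suc b))
    ≈⟨ ℚᵘₚ.*-cong (ℚₚ.toℚᵘ-fromℚᵘ (ℚᵘ.mkℚᵘ (+ a) b)) (ℚₚ.toℚᵘ-fromℚᵘ (ℚᵘ.mkℚᵘ (+ suc b) 0)) ⟩
      ℚᵘ.mkℚᵘ (+ a) b ℚᵘ.* ℚᵘ.mkℚᵘ (+ suc b) 0
    ≈⟨ ℚᵘ.*≡* cross-multiplied ⟩
      ℚᵘ.mkℚᵘ (+ a) 0
    ≈⟨ ℚᵘₚ.≃-sym (ℚₚ.toℚᵘ-fromℚᵘ (ℚᵘ.mkℚᵘ (+ a) 0)) ⟩
      ℚ.toℚᵘ (ℕ→ℚ a) ∎)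
    where
      open ℚᵘₚ.≃-Reasoning
      cross-multiplied : (+ a ℤ.* + suc b) ℤ.* + 1 ≡ + a ℤ.* + (suc b ℕ.* 1)
      cross-multiplied = trans (ℤₚ.*-identityʳ _) (cong (λ k → + a ℤ.* + k) (sym (ℕₚ.*-identityʳ (suc b))))

  0≤q-p⇒p≤q : ∀ {p q} → 0ℚ ≤ q - p → p ≤ q
  0≤q-p⇒p≤q {p} {q} 0≤q-p = subst₂ _≤_ (ℚₚ.+-identityˡ p) (solve 2 (λ p q → (q :- p) :+ p := q) refl p q) (ℚₚ.+-monoˡ-≤ p 0≤q-p)

  p≤q⇒0≤q-p : ∀ {p q} → p ≤ q → 0ℚ ≤ q - p
  p≤q⇒0≤q-p {p} {q} p≤q = subst (_≤ q - p) (ℚₚ.+-inverseʳ p) (ℚₚ.+-monoˡ-≤ (- p) p≤q)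

  p≤q⇒p-q≤0 : ∀ {p q} → p ≤ q → p - q ≤ 0ℚ
  p≤q⇒p-q≤0 {p} {q} p≤q = subst (_≤ 0ℚ) (solve 2 (λ p q → :- (q :- p) := p :- q) refl p q) (ℚₚ.neg-antimono-≤ (p≤q⇒0≤q-p p≤q))

  <⇒≱ : ∀ {p q} → p < q → ¬ (q ≤ p)
  <⇒≱ p<q q≤p = ℚₚ.<-irrefl refl (ℚₚ.<-≤-trans p<q q≤p)

  ≤-byDifference : ∀ {p q} (r : ℚ) → q - p ≡ r → 0ℚ ≤ r → p ≤ q
  ≤-byDifference r q-p≡r 0≤r = 0≤q-p⇒p≤q (subst (0ℚ ≤_) (sym q-p≡r) 0≤r)

  0≤+ : ∀ {p q} → 0ℚ ≤ p → 0ℚ ≤ q → 0ℚ ≤ p + q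
  0≤+ = ℚₚ.+-mono-≤

  0≤* : ∀ {p q} → 0ℚ ≤ p → 0ℚ ≤ q → 0ℚ ≤ p * q
  0≤* {p} {q} 0≤p 0≤q = subst (_≤ p * q) (ℚₚ.*-zeroˡ q) (ℚₚ.*-monoʳ-≤-nonNeg q {{ℚ.nonNegative 0≤q}} 0≤p)

  0≤*-cancelˡ : ∀ {r p} → 0ℚ < r → 0ℚ ≤ r * p → 0ℚ ≤ p
  0≤*-cancelˡ {r} {p} 0<r 0≤rp = ℚₚ.*-cancelˡ-≤-pos r {{ℚ.positive 0<r}} (subst (_≤ r * p) (sym (ℚₚ.*-zeroʳ r)) 0≤rp)

  ≤-byScaledDifference : ∀ {p q r} (s : ℚ) → 0ℚ < r → r * (q - p) ≡ s → 0ℚ ≤ s → p ≤ q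
  ≤-byScaledDifference s 0<r r[q-p]≡s 0≤s = 0≤q-p⇒p≤q (0≤*-cancelˡ 0<r (subst (0ℚ ≤_) (sym r[q-p]≡s) 0≤s))

  ≤-byComputation : ∀ {p q} → True (p ℚₚ.≤? q) → p ≤ q
  ≤-byComputation = toWitness

  *-mono-≤-nonNeg : ∀ {a b c d} → 0ℚ ≤ a → a ≤ b → 0ℚ ≤ c → c ≤ d → a * c ≤ b * d
  *-mono-≤-nonNeg {a} {b} {c} {d} 0≤a a≤b 0≤c c≤d = ℚₚ.≤-trans
    (ℚₚ.*-monoʳ-≤-nonNeg c {{ℚ.nonNegative 0≤c}} a≤b)
    (ℚₚ.*-monoˡ-≤-nonNeg b {{ℚ.nonNegative (ℚₚ.≤-trans 0≤a a≤b)}} c≤d)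

  p≤p+q : ∀ {p q} → 0ℚ ≤ q → p ≤ p + q
  p≤p+q {p} {q} 0≤q = ≤-byDifference q (solve 2 (λ p q → (p :+ q) :- p := q) refl p q) 0≤q

  p≤[1+ε]*p : ∀ {ε p} → 0ℚ ≤ ε → 0ℚ ≤ p → p ≤ (1ℚ + ε) * p
  p≤[1+ε]*p {ε} {p} 0≤ε 0≤p = ≤-byDifference (ε * p) (solve 2 (λ ε p → (con 1ℚ :+ ε) :* p :- p := ε :* p) refl ε p) (0≤* 0≤ε 0≤p)

  p≤q⇒p-q≤ε*p : ∀ {ε p q} → 0ℚ ≤ ε → 0ℚ ≤ p → p ≤ q → p - q ≤ ε * p
  p≤q⇒p-q≤ε*p 0≤ε 0≤p p≤q = ℚₚ.≤-trans (p≤q⇒p-q≤0 p≤q) (0≤* 0≤ε 0≤p)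

  1≤ε⇒p-q≤ε*p : ∀ {ε p q} → 1ℚ ≤ ε → 0ℚ ≤ p → 0ℚ ≤ q → p - q ≤ ε * p
  1≤ε⇒p-q≤ε*p {ε} {p} {q} 1≤ε 0≤p 0≤q = ≤-byDifference ((ε - 1ℚ) * p + q)
    (solve 3 (λ ε p q → ε :* p :- (p :- q) := (ε :- con 1ℚ) :* p :+ q) refl ε p q)
    (0≤+ (0≤* (p≤q⇒0≤q-p 1≤ε) 0≤p) 0≤q)

  1+[L-1]≡L : ∀ L → 1ℚ + (L - 1ℚ) ≡ L
  1+[L-1]≡L L = solve 1 (λ L → con 1ℚ :+ (L :- con 1ℚ) := L) refl L

  K*[S-y]≤M*[M-z] : ∀ {K S M y z} → 0ℚ ≤ K → K ≤ M → S ≤ M → z ≤ y → 0ℚ ≤ M * (M - z) → K * (S - y) ≤ M * (M - z)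
  K*[S-y]≤M*[M-z] {K} {S} {M} {y} {z} 0≤K K≤M S≤M z≤y 0≤M[M-z] with y ℚₚ.≤? S
  ... | yes y≤S = *-mono-≤-nonNeg 0≤K K≤M (p≤q⇒0≤q-p y≤S)
                    (ℚₚ.+-mono-≤ S≤M (ℚₚ.neg-antimono-≤ z≤y))
  ... | no y≰S = ℚₚ.≤-trans (ℚₚ.*-monoˡ-≤-nonNeg K {{ℚ.nonNegative 0≤K}} (p≤q⇒p-q≤0 (ℚₚ.<⇒≤ (ℚₚ.≰⇒> y≰S))))
                  (ℚₚ.≤-trans (ℚₚ.≤-reflexive (ℚₚ.*-zeroʳ K)) 0≤M[M-z])

  ∣p-q∣≤r-intro : ∀ {p q r} → p - q ≤ r → q - p ≤ r → ∣ p - q ∣ ≤ r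
  ∣p-q∣≤r-intro {p} {q} {r} p-q≤r q-p≤r with ℚₚ.∣p∣≡p∨∣p∣≡-p (p - q)
  ... | inj₁ ∣p-q∣≡p-q = subst (_≤ r) (sym ∣p-q∣≡p-q) p-q≤r
  ... | inj₂ ∣p-q∣≡q-p = subst (_≤ r) (sym (trans ∣p-q∣≡q-p (solve 2 (λ p q → :- (p :- q) := q :- p) refl p q))) q-p≤r

  ∣p-q∣≤r⇒q-p≤r : ∀ p q {r} → ∣ p - q ∣ ≤ r → q - p ≤ r
  ∣p-q∣≤r⇒q-p≤r p q {r} ∣p-q∣≤r with ℚₚ.∣p∣≡p∨∣p∣≡-p (p - q)
  ... | inj₂ ∣p-q∣≡q-p = subst (_≤ r) (trans ∣p-q∣≡q-p (solve 2 (λ p q → :- (p :- q) := q :- p) refl p q)) ∣p-q∣≤r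
  ... | inj₁ ∣p-q∣≡p-q = ℚₚ.≤-trans (p≤q⇒p-q≤0 q≤p) (ℚₚ.≤-trans (ℚₚ.0≤∣p∣ (p - q)) ∣p-q∣≤r)
    where
      q≤p : q ≤ p
      q≤p = 0≤q-p⇒p≤q (subst (0ℚ ≤_) ∣p-q∣≡p-q (ℚₚ.0≤∣p∣ (p - q)))

  ∣p-q∣≤ε*p : ∀ ε p q → p - q ≤ ε * p → q ≤ (1ℚ + ε) * p → ∣ p - q ∣ ≤ ε * p
  ∣p-q∣≤ε*p ε p q p-q≤εp q≤[1+ε]p = ∣p-q∣≤r-intro {p} {q} p-q≤εp
    (≤-byDifference ((1ℚ + ε) * p - q) (solve 3 (λ ε p q → ε :* p :- (q :- p) := (con 1ℚ :+ ε) :* p :- q) refl ε p q) (p≤q⇒0≤q-p q≤[1+ε]p))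

  ∃-convex-weight : ∀ {a b p} → b ℕ.< p → p ℕ.≤ a →
    ∃[ r ] 0ℚ ≤ r × r ≤ 1ℚ × ℕ→ℚ a - r * (ℕ→ℚ a - ℕ→ℚ b) ≡ ℕ→ℚ p
  ∃-convex-weight {a} {b} {p} b<p p≤a = r , 0≤r , r≤1 , hits
    where
      A = ℕ→ℚ a
      B = ℕ→ℚ b
      P = ℕ→ℚ p
      w = a ℕ.∸ suc b
      W = ℕ→ℚ (suc w)
      W≡A-B : W ≡ A - B
      W≡A-B = begin
        ℕ→ℚ (suc w)                   ≡⟨ ℕ→ℚ-suc w ⟩
        1ℚ + ℕ→ℚ w                    ≡⟨ cong (λ z → 1ℚ + z) (ℕ→ℚ-∸ (ℕₚ.<-≤-trans b<p p≤a)) ⟩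
        1ℚ + (A - ℕ→ℚ (suc b))        ≡⟨ cong (λ z → 1ℚ + (A - z)) (ℕ→ℚ-suc b) ⟩
        1ℚ + (A - (1ℚ + B))           ≡⟨ solve 2 (λ A B → con 1ℚ :+ (A :- (con 1ℚ :+ B)) := A :- B) refl A B ⟩
        A - B                         ∎
        where open ≡-Reasoning
      r = + (a ℕ.∸ p) / suc w
      rW≡A-P : r * W ≡ A - P
      rW≡A-P = trans (/-*-cancel (a ℕ.∸ p) w) (ℕ→ℚ-∸ p≤a)
      0≤r : 0ℚ ≤ r
      0≤r = 0≤*-cancelˡ (0<ℕ→ℚ-suc w)
              (subst (0ℚ ≤_) (trans (sym rW≡A-P) (ℚₚ.*-comm r W)) (p≤q⇒0≤q-p (ℕ→ℚ-mono-≤ p≤a)))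
      r≤1 : r ≤ 1ℚ
      r≤1 = ≤-byScaledDifference (P - B) (0<ℕ→ℚ-suc w) W[1-r]≡P-B (p≤q⇒0≤q-p (ℕ→ℚ-mono-≤ (ℕₚ.<⇒≤ b<p)))
        where
          W[1-r]≡P-B : W * (1ℚ - r) ≡ P - B
          W[1-r]≡P-B = begin
            W * (1ℚ - r)        ≡⟨ solve 2 (λ W r → W :* (con 1ℚ :- r) := W :- r :* W) refl W r ⟩
            W - r * W           ≡⟨ cong₂ _-_ W≡A-B rW≡A-P ⟩
            (A - B) - (A - P)   ≡⟨ solve 3 (λ A B P → (A :- B) :- (A :- P) := P :- B) refl A B P ⟩
            P - B               ∎
            where open ≡-Reasoning
      hits : A - r * (A - B) ≡ P
      hits = begin
        A - r * (A - B)   ≡⟨ cong (λ z → A - r * z) (sym W≡A-B) ⟩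
        A - r * W         ≡⟨ cong (λ z → A - z) rW≡A-P ⟩
        A - (A - P)       ≡⟨ solve 2 (λ A P → A :- (A :- P) := P) refl A P ⟩
        P                 ∎
        where open ≡-Reasoning

  -- Piecewise-linear interpolation

  ⌊_⌋ₙ : ℚ → ℕ
  ⌊ x ⌋ₙ = ℤ.∣ ℚ.floor x ∣

  ⌊x⌋ₙ≤x∧x<⌊x⌋ₙ+1 : ∀ x → 0ℚ ≤ x → ℕ→ℚ ⌊ x ⌋ₙ ≤ x × x < ℕ→ℚ (suc ⌊ x ⌋ₙ)
  ⌊x⌋ₙ≤x∧x<⌊x⌋ₙ+1 x@(mkℚ (+ N) k _) _ =
    subst (λ i → ℕ→ℚ i ≤ x × x < ℕ→ℚ (suc i)) (sym ⌊x⌋ₙ≡N/n) (j≤x , x<j+1)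
    where
      n = suc k
      j = N ℕ./ n
      ⌊x⌋ₙ≡N/n : ⌊ x ⌋ₙ ≡ j
      ⌊x⌋ₙ≡N/n = cong ℤ.∣_∣ (ℤₚ.*-identityˡ (+ j))
      N≡N%n+jn : N ≡ N ℕ.% n ℕ.+ j ℕ.* n
      N≡N%n+jn = ℕ.m≡m%n+[m/n]*n N n
      j≤x : ℕ→ℚ j ≤ x
      j≤x rewrite ℕ→ℚ≡mkℚ j = *≤* (subst₂ ℤ._≤_ (ℤₚ.pos-* j n) (sym (ℤₚ.*-identityʳ (+ N)))
        (ℤ.+≤+ (subst (j ℕ.* n ℕ.≤_) (sym N≡N%n+jn) (ℕₚ.m≤n+m (j ℕ.* n) (N ℕ.% n)))))
      x<j+1 : x < ℕ→ℚ (suc j)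
      x<j+1 rewrite ℕ→ℚ≡mkℚ (suc j) = *<* (subst₂ ℤ._<_ (sym (ℤₚ.*-identityʳ (+ N))) (ℤₚ.pos-* (suc j) n)
        (ℤ.+<+ (subst (ℕ._< n ℕ.+ j ℕ.* n) (sym N≡N%n+jn) (ℕₚ.+-monoˡ-< (j ℕ.* n) (ℕ.m%n<n N n)))))
  ⌊x⌋ₙ≤x∧x<⌊x⌋ₙ+1 (mkℚ -[1+ _ ] _ _) (*≤* ())

  ⌊x⌋ₙ≤x : ∀ {x} → 0ℚ ≤ x → ℕ→ℚ ⌊ x ⌋ₙ ≤ x
  ⌊x⌋ₙ≤x {x} 0≤x = proj₁ (⌊x⌋ₙ≤x∧x<⌊x⌋ₙ+1 x 0≤x)

  x<⌊x⌋ₙ+1 : ∀ {x} → 0ℚ ≤ x → x < 1ℚ + ℕ→ℚ ⌊ x ⌋ₙ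
  x<⌊x⌋ₙ+1 {x} 0≤x = subst (x <_) (ℕ→ℚ-suc ⌊ x ⌋ₙ) (proj₂ (⌊x⌋ₙ≤x∧x<⌊x⌋ₙ+1 x 0≤x))

  ⌊⌋ₙ-unique : ∀ i {x} → ℕ→ℚ i ≤ x → x < ℕ→ℚ (suc i) → ⌊ x ⌋ₙ ≡ i
  ⌊⌋ₙ-unique i {x} i≤x x<i+1 = ℕₚ.≤-antisym
    (ℕₚ.≤-pred (ℕ→ℚ-cancel-< (ℚₚ.≤-<-trans (⌊x⌋ₙ≤x 0≤x) x<i+1)))
    (ℕₚ.≤-pred (ℕ→ℚ-cancel-< (ℚₚ.≤-<-trans i≤x (proj₂ (⌊x⌋ₙ≤x∧x<⌊x⌋ₙ+1 x 0≤x)))))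
    where
      0≤x : 0ℚ ≤ x
      0≤x = ℚₚ.≤-trans (0≤ℕ→ℚ i) i≤x

  -- φ H from Defs is, by definition, interp (ccdh H).
  interp : (ℕ → ℕ) → ℚ → ℚ
  interp t x = (1ℚ - (x - ℕ→ℚ ⌊ x ⌋ₙ)) * ℕ→ℚ (t ⌊ x ⌋ₙ) + (x - ℕ→ℚ ⌊ x ⌋ₙ) * ℕ→ℚ (t (suc ⌊ x ⌋ₙ))

  chord : (ℕ → ℕ) → ℕ → ℚ → ℚ
  chord t i x = ((1ℚ + ℕ→ℚ i) - x) * ℕ→ℚ (t i) + (x - ℕ→ℚ i) * ℕ→ℚ (t (suc i))

  interp≡chord-⌊⌋ₙ : ∀ t x → interp t x ≡ chord t ⌊ x ⌋ₙ x
  interp≡chord-⌊⌋ₙ t x = solve 4 (λ x i a b → (con 1ℚ :- (x :- i)) :* a :+ (x :- i) :* b := ((con 1ℚ :+ i) :- x) :* a :+ (x :- i) :* b)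
    refl x (ℕ→ℚ ⌊ x ⌋ₙ) (ℕ→ℚ (t ⌊ x ⌋ₙ)) (ℕ→ℚ (t (suc ⌊ x ⌋ₙ)))

  chord-left : ∀ t i → chord t i (ℕ→ℚ i) ≡ ℕ→ℚ (t i)
  chord-left t i = solve 3 (λ i a b → ((con 1ℚ :+ i) :- i) :* a :+ (i :- i) :* b := a) refl (ℕ→ℚ i) (ℕ→ℚ (t i)) (ℕ→ℚ (t (suc i)))

  chord-right : ∀ t i → chord t i (ℕ→ℚ (suc i)) ≡ ℕ→ℚ (t (suc i))
  chord-right t i rewrite ℕ→ℚ-suc i =
    solve 3 (λ i a b → ((con 1ℚ :+ i) :- (con 1ℚ :+ i)) :* a :+ ((con 1ℚ :+ i) :- i) :* b := b) refl (ℕ→ℚ i) (ℕ→ℚ (t i)) (ℕ→ℚ (t (suc i)))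

  chord-difference : ∀ t i x y → chord t i x - chord t i y ≡ (y - x) * (ℕ→ℚ (t i) - ℕ→ℚ (t (suc i)))
  chord-difference t i x y = solve 5
    (λ i x y a b → (((con 1ℚ :+ i) :- x) :* a :+ (x :- i) :* b) :- (((con 1ℚ :+ i) :- y) :* a :+ (y :- i) :* b) := (y :- x) :* (a :- b))
    refl (ℕ→ℚ i) x y (ℕ→ℚ (t i)) (ℕ→ℚ (t (suc i)))

  ⌊ℕ→ℚ⌋ₙ : ∀ i → ⌊ ℕ→ℚ i ⌋ₙ ≡ i
  ⌊ℕ→ℚ⌋ₙ i = ⌊⌋ₙ-unique i ℚₚ.≤-refl (ℕ→ℚ-mono-< (ℕₚ.n<1+n i))

  interp-ℕ : ∀ t i → interp t (ℕ→ℚ i) ≡ ℕ→ℚ (t i)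
  interp-ℕ t i = trans (interp≡chord-⌊⌋ₙ t (ℕ→ℚ i)) (trans (cong (λ j → chord t j (ℕ→ℚ i)) (⌊ℕ→ℚ⌋ₙ i)) (chord-left t i))

  interp≡chord : ∀ t i {x} → ℕ→ℚ i ≤ x → x ≤ ℕ→ℚ (suc i) → interp t x ≡ chord t i x
  interp≡chord t i {x} i≤x x≤i+1 = by-cases (x ℚₚ.<? ℕ→ℚ (suc i))
    where
      by-cases : Dec (x < ℕ→ℚ (suc i)) → interp t x ≡ chord t i x
      by-cases (yes x<i+1) = trans (interp≡chord-⌊⌋ₙ t x) (cong (λ j → chord t j x) (⌊⌋ₙ-unique i i≤x x<i+1))
      by-cases (no x≮i+1) = subst (λ x → interp t x ≡ chord t i x) (sym (ℚₚ.≤-antisym x≤i+1 (ℚₚ.≮⇒≥ x≮i+1)))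
                              (trans (interp-ℕ t (suc i)) (sym (chord-right t i)))

  module _ {t : ℕ → ℕ} (t-antitone : t Preserves ℕ._≤_ ⟶ ℕ._≥_) where

    0≤t[i]-t[i+1] : ∀ i → 0ℚ ≤ ℕ→ℚ (t i) - ℕ→ℚ (t (suc i))
    0≤t[i]-t[i+1] i = p≤q⇒0≤q-p (ℕ→ℚ-mono-≤ (t-antitone (ℕₚ.n≤1+n i)))

    interp≤t[⌊x⌋] : ∀ {x} → 0ℚ ≤ x → interp t x ≤ ℕ→ℚ (t ⌊ x ⌋ₙ)
    interp≤t[⌊x⌋] {x} 0≤x = ≤-byDifference ((x - ℕ→ℚ i) * (ℕ→ℚ (t i) - ℕ→ℚ (t (suc i))))
      (trans (cong₂ _-_ (sym (chord-left t i)) (interp≡chord-⌊⌋ₙ t x)) (chord-difference t i (ℕ→ℚ i) x))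
      (0≤* (p≤q⇒0≤q-p (⌊x⌋ₙ≤x 0≤x)) (0≤t[i]-t[i+1] i))
      where i = ⌊ x ⌋ₙ

    t[⌊x⌋+1]≤interp : ∀ {x} → 0ℚ ≤ x → ℕ→ℚ (t (suc ⌊ x ⌋ₙ)) ≤ interp t x
    t[⌊x⌋+1]≤interp {x} 0≤x = ≤-byDifference (((1ℚ + ℕ→ℚ i) - x) * (ℕ→ℚ (t i) - ℕ→ℚ (t (suc i))))
      (trans (cong₂ _-_ (interp≡chord-⌊⌋ₙ t x) (trans (sym (chord-right t i)) (cong (chord t i) (ℕ→ℚ-suc i))))
             (chord-difference t i x (1ℚ + ℕ→ℚ i)))
      (0≤* (p≤q⇒0≤q-p (ℚₚ.<⇒≤ (x<⌊x⌋ₙ+1 0≤x))) (0≤t[i]-t[i+1] i))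
      where i = ⌊ x ⌋ₙ

    interp-antitone : ∀ {x y} → 0ℚ ≤ x → x ≤ y → interp t y ≤ interp t x
    interp-antitone {x} {y} 0≤x x≤y = by-cases (suc ⌊ x ⌋ₙ ℕ.≤? ⌊ y ⌋ₙ)
      where
        0≤y = ℚₚ.≤-trans 0≤x x≤y
        by-cases : Dec (suc ⌊ x ⌋ₙ ℕ.≤ ⌊ y ⌋ₙ) → interp t y ≤ interp t x
        by-cases (yes ⌊x⌋<⌊y⌋) = ℚₚ.≤-trans (interp≤t[⌊x⌋] 0≤y) (ℚₚ.≤-trans (ℕ→ℚ-mono-≤ (t-antitone ⌊x⌋<⌊y⌋)) (t[⌊x⌋+1]≤interp 0≤x))
        by-cases (no ⌊x⌋≮⌊y⌋) = ≤-byDifference ((y - x) * (ℕ→ℚ (t ⌊ x ⌋ₙ) - ℕ→ℚ (t (suc ⌊ x ⌋ₙ))))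
          (trans (cong₂ _-_ (interp≡chord-⌊⌋ₙ t x) (trans (interp≡chord-⌊⌋ₙ t y) (cong (λ k → chord t k y) (sym ⌊x⌋≡⌊y⌋))))
                 (chord-difference t ⌊ x ⌋ₙ x y))
          (0≤* (p≤q⇒0≤q-p x≤y) (0≤t[i]-t[i+1] ⌊ x ⌋ₙ))
          where
            ⌊x⌋≡⌊y⌋ : ⌊ x ⌋ₙ ≡ ⌊ y ⌋ₙ
            ⌊x⌋≡⌊y⌋ = ℕₚ.≤-antisym
              (ℕₚ.≤-pred (ℕ→ℚ-cancel-< (ℚₚ.≤-<-trans (ℚₚ.≤-trans (⌊x⌋ₙ≤x 0≤x) x≤y) (proj₂ (⌊x⌋ₙ≤x∧x<⌊x⌋ₙ+1 y 0≤y)))))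
              (ℕₚ.≤-pred (ℕₚ.≰⇒> ⌊x⌋≮⌊y⌋))

  threshold-crossing : ∀ (f : ℕ → ℕ) {p} D → p ℕ.≤ f 1 → f (suc D) ℕ.< p →
    ∃[ j ] 1 ℕ.≤ j × j ℕ.≤ D × p ℕ.≤ f j × f (suc j) ℕ.< p
  threshold-crossing f zero p≤f1 f1<p = ⊥-elim (ℕₚ.<⇒≱ f1<p p≤f1)
  threshold-crossing f {p} (suc D) p≤f1 f[D+2]<p with p ℕ.≤? f (suc D)
  ... | yes p≤f[D+1] = suc D , s≤s z≤n , ℕₚ.≤-refl , p≤f[D+1] , f[D+2]<p
  ... | no p≰f[D+1] with threshold-crossing f D p≤f1 (ℕₚ.≰⇒> p≰f[D+1])
  ...   | j , 1≤j , j≤D , p≤fj , f[j+1]<p = j , 1≤j , ℕₚ.m≤n⇒m≤1+n j≤D , p≤fj , f[j+1]<p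

  interp-attains : ∀ t {p} j → t (suc j) ℕ.< p → p ℕ.≤ t j →
    ∃[ x ] ℕ→ℚ j ≤ x × x ≤ 1ℚ + ℕ→ℚ j × interp t x ≡ ℕ→ℚ p
  interp-attains t {p} j t[j+1]<p p≤tj = at-weight (∃-convex-weight t[j+1]<p p≤tj)
    where
      J = ℕ→ℚ j
      A = ℕ→ℚ (t j)
      B = ℕ→ℚ (t (suc j))
      at-weight : (∃[ r ] 0ℚ ≤ r × r ≤ 1ℚ × A - r * (A - B) ≡ ℕ→ℚ p) →
        ∃[ x ] J ≤ x × x ≤ 1ℚ + J × interp t x ≡ ℕ→ℚ p
      at-weight (r , 0≤r , r≤1 , hits) = J + r , J≤J+r , J+r≤1+J , (begin
        interp t (J + r)    ≡⟨ interp≡chord t j J≤J+r (subst (J + r ≤_) (sym (ℕ→ℚ-suc j)) J+r≤1+J) ⟩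
        chord t j (J + r)   ≡⟨ solve 4 (λ J r a b → ((con 1ℚ :+ J) :- (J :+ r)) :* a :+ ((J :+ r) :- J) :* b := a :- r :* (a :- b)) refl J r A B ⟩
        A - r * (A - B)     ≡⟨ hits ⟩
        ℕ→ℚ p               ∎)
        where
          open ≡-Reasoning
          J≤J+r : J ≤ J + r
          J≤J+r = ≤-byDifference r (solve 2 (λ J r → (J :+ r) :- J := r) refl J r) 0≤r
          J+r≤1+J : J + r ≤ 1ℚ + J
          J+r≤1+J = ≤-byDifference (1ℚ - r) (solve 2 (λ J r → (con 1ℚ :+ J) :- (J :+ r) := con 1ℚ :- r) refl J r) (p≤q⇒0≤q-p r≤1)

  -- Matching a degree against a ccdh

  -- What the matching argument uses about G: f = f_G, order = |V(G)|, maxDegree = Δ(G).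
  record CcdhShape : Set where
    field
      f            : ℕ → ℕ
      order        : ℕ
      maxDegree    : ℕ
      f-antitone   : f Preserves ℕ._≤_ ⟶ ℕ._≥_
      f≤order      : ∀ a → f a ℕ.≤ order
      f-1          : f 1 ≡ order
      f-beyond-max : f (suc maxDegree) ≡ 0

  module _ (G : CcdhShape) where
    open CcdhShape G

    interp≤order : ∀ {y} → 0ℚ ≤ y → interp f y ≤ ℕ→ℚ order
    interp≤order 0≤y = ℚₚ.≤-trans (interp≤t[⌊x⌋] f-antitone 0≤y) (ℕ→ℚ-mono-≤ (f≤order _))

    interp≤order*[Δ+1-y] : ∀ {y} → 0ℚ ≤ y → y ≤ ℕ→ℚ (suc maxDegree) →
      interp f y ≤ ℕ→ℚ order * (ℕ→ℚ (suc maxDegree) - y)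
    interp≤order*[Δ+1-y] {y} 0≤y y≤Δ+1 = by-cases (y ℚₚ.≤? ℕ→ℚ maxDegree)
      where
        K = ℕ→ℚ order
        D = ℕ→ℚ maxDegree
        by-cases : Dec (y ≤ D) → interp f y ≤ K * (ℕ→ℚ (suc maxDegree) - y)
        by-cases (yes y≤Δ) = ℚₚ.≤-trans (interp≤order 0≤y) (≤-byDifference (K * (D - y)) (begin
          K * (ℕ→ℚ (suc maxDegree) - y) - K   ≡⟨ cong (λ z → K * (z - y) - K) (ℕ→ℚ-suc maxDegree) ⟩
          K * ((1ℚ + D) - y) - K              ≡⟨ solve 3 (λ K D y → K :* ((con 1ℚ :+ D) :- y) :- K := K :* (D :- y)) refl K D y ⟩
          K * (D - y)                         ∎) (0≤* (0≤ℕ→ℚ order) (p≤q⇒0≤q-p y≤Δ)))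
          where open ≡-Reasoning
        by-cases (no y≰Δ) = ≤-byDifference ((ℕ→ℚ (suc maxDegree) - y) * (K - fΔ)) (begin
          K * (ℕ→ℚ (suc maxDegree) - y) - interp f y
            ≡⟨ cong (λ z → K * (ℕ→ℚ (suc maxDegree) - y) - z) (interp≡chord f maxDegree (ℚₚ.<⇒≤ (ℚₚ.≰⇒> y≰Δ)) y≤Δ+1) ⟩
          K * (ℕ→ℚ (suc maxDegree) - y) - chord f maxDegree y
            ≡⟨ cong₂ (λ u v → K * (u - y) - (((1ℚ + D) - y) * fΔ + (y - D) * ℕ→ℚ v)) (ℕ→ℚ-suc maxDegree) f-beyond-max ⟩
          K * ((1ℚ + D) - y) - (((1ℚ + D) - y) * fΔ + (y - D) * 0ℚ)
            ≡⟨ solve 4 (λ K D y a → K :* ((con 1ℚ :+ D) :- y) :- (((con 1ℚ :+ D) :- y) :* a :+ (y :- D) :* con 0ℚ) := ((con 1ℚ :+ D) :- y) :* (K :- a)) refl K D y fΔ ⟩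
          ((1ℚ + D) - y) * (K - fΔ)
            ≡⟨ cong (λ u → (u - y) * (K - fΔ)) (ℕ→ℚ-suc maxDegree) ⟨
          (ℕ→ℚ (suc maxDegree) - y) * (K - fΔ) ∎)
          (0≤* (p≤q⇒0≤q-p y≤Δ+1) (p≤q⇒0≤q-p (ℕ→ℚ-mono-≤ (f≤order maxDegree))))
          where
            open ≡-Reasoning
            fΔ = ℕ→ℚ (f maxDegree)

    crossing-point : ∀ {p} → 1 ℕ.≤ p → p ℕ.< order →
      ∃[ x ] 1ℚ ≤ x × x ≤ ℕ→ℚ (suc maxDegree) × interp f x ≡ ℕ→ℚ p
    crossing-point {p} 1≤p p<order = at-index
      (threshold-crossing f maxDegree (subst (p ℕ.≤_) (sym f-1) (ℕₚ.<⇒≤ p<order)) (subst (ℕ._< p) (sym f-beyond-max) 1≤p))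
      where
        at-index : ∃[ j ] 1 ℕ.≤ j × j ℕ.≤ maxDegree × p ℕ.≤ f j × f (suc j) ℕ.< p →
          ∃[ x ] 1ℚ ≤ x × x ≤ ℕ→ℚ (suc maxDegree) × interp f x ≡ ℕ→ℚ p
        at-index (j , 1≤j , j≤Δ , p≤fj , f[j+1]<p) = widen (interp-attains f j f[j+1]<p p≤fj)
          where
            widen : ∃[ x ] ℕ→ℚ j ≤ x × x ≤ 1ℚ + ℕ→ℚ j × interp f x ≡ ℕ→ℚ p →
              ∃[ x ] 1ℚ ≤ x × x ≤ ℕ→ℚ (suc maxDegree) × interp f x ≡ ℕ→ℚ p
            widen (x , j≤x , x≤1+j , fx≡p) = x , ℚₚ.≤-trans (ℕ→ℚ-mono-≤ 1≤j) j≤x ,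
              ℚₚ.≤-trans x≤1+j (subst (_≤ ℕ→ℚ (suc maxDegree)) (ℕ→ℚ-suc j) (ℕ→ℚ-mono-≤ (s≤s j≤Δ))) , fx≡p

    Matched : ℚ → ℕ → ℕ → Set
    Matched ε d p = ∃[ d' ] 1ℚ ≤ d' × d' ≤ ℕ→ℚ (suc maxDegree) ×
      ∣ ℕ→ℚ d - d' ∣ ≤ ε * ℕ→ℚ d × ∣ ℕ→ℚ p - interp f d' ∣ ≤ ε * ℕ→ℚ p

    record Slack (ε : ℚ) (d p : ℕ) : Set where
      field
        degree-slack  : ℕ→ℚ d - 1ℚ ≤ ε * ℕ→ℚ d
        surplus-slack : order ℕ.≤ p → ℕ→ℚ p - ℕ→ℚ order ≤ ε * ℕ→ℚ p
        deficit-slack : p ℕ.< order →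
          ℕ→ℚ order * (ℕ→ℚ (suc maxDegree) - (1ℚ + ε) * ℕ→ℚ d) ≤ (1ℚ + ε) * ℕ→ℚ p ⊎ ℕ→ℚ order ≤ (1ℚ + ε) * ℕ→ℚ p

    module _ {ε : ℚ} {d p : ℕ} (0≤ε : 0ℚ ≤ ε) (1≤d : 1 ℕ.≤ d) (slack : Slack ε d p) where
      open Slack slack

      1≤[1+ε]d : 1ℚ ≤ (1ℚ + ε) * ℕ→ℚ d
      1≤[1+ε]d = ℚₚ.≤-trans (ℕ→ℚ-mono-≤ 1≤d) (p≤[1+ε]*p 0≤ε (0≤ℕ→ℚ d))

      matched-at-1 : order ℕ.≤ p → Matched ε d p
      matched-at-1 order≤p = 1ℚ , ℚₚ.≤-refl , ℕ→ℚ-mono-≤ {1} {suc maxDegree} (s≤s z≤n) ,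
        ∣p-q∣≤ε*p ε (ℕ→ℚ d) 1ℚ degree-slack 1≤[1+ε]d ,
        subst (λ z → ∣ ℕ→ℚ p - z ∣ ≤ ε * ℕ→ℚ p) (sym (trans (interp-ℕ f 1) (cong ℕ→ℚ f-1)))
          (∣p-q∣≤ε*p ε (ℕ→ℚ p) (ℕ→ℚ order) (surplus-slack order≤p)
            (ℚₚ.≤-trans (ℕ→ℚ-mono-≤ order≤p) (p≤[1+ε]*p 0≤ε (0≤ℕ→ℚ p))))

      matched-at-crossing : ∀ {x} → 1ℚ ≤ x → x ≤ ℕ→ℚ (suc maxDegree) → interp f x ≡ ℕ→ℚ p →
        x ≤ (1ℚ + ε) * ℕ→ℚ d → Matched ε d p
      matched-at-crossing {x} 1≤x x≤Δ+1 fx≡p x≤[1+ε]d = x , 1≤x , x≤Δ+1 ,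
        ∣p-q∣≤ε*p ε (ℕ→ℚ d) x (ℚₚ.≤-trans (ℚₚ.+-monoʳ-≤ (ℕ→ℚ d) (ℚₚ.neg-antimono-≤ 1≤x)) degree-slack) x≤[1+ε]d ,
        subst (λ z → ∣ ℕ→ℚ p - z ∣ ≤ ε * ℕ→ℚ p) (sym fx≡p)
          (∣p-q∣≤ε*p ε (ℕ→ℚ p) (ℕ→ℚ p) (p≤q⇒p-q≤ε*p 0≤ε (0≤ℕ→ℚ p) ℚₚ.≤-refl) (p≤[1+ε]*p 0≤ε (0≤ℕ→ℚ p)))

      matched-at-[1+ε]d : ∀ {x} → p ℕ.< order → x ≤ ℕ→ℚ (suc maxDegree) → interp f x ≡ ℕ→ℚ p →
        (1ℚ + ε) * ℕ→ℚ d ≤ x → Matched ε d p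
      matched-at-[1+ε]d {x} p<order x≤Δ+1 fx≡p [1+ε]d≤x = (1ℚ + ε) * ℕ→ℚ d , 1≤[1+ε]d , [1+ε]d≤Δ+1 ,
        ∣p-q∣≤ε*p ε (ℕ→ℚ d) ((1ℚ + ε) * ℕ→ℚ d) (p≤q⇒p-q≤ε*p 0≤ε (0≤ℕ→ℚ d) (p≤[1+ε]*p 0≤ε (0≤ℕ→ℚ d))) ℚₚ.≤-refl ,
        ∣p-q∣≤ε*p ε (ℕ→ℚ p) (interp f ((1ℚ + ε) * ℕ→ℚ d)) (p≤q⇒p-q≤ε*p 0≤ε (0≤ℕ→ℚ p) p≤f[[1+ε]d]) (f[[1+ε]d]≤[1+ε]p (deficit-slack p<order))
        where
          [1+ε]d≤Δ+1 = ℚₚ.≤-trans [1+ε]d≤x x≤Δ+1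
          0≤[1+ε]d = ℚₚ.≤-trans (ℕ→ℚ-mono-≤ {0} {1} z≤n) 1≤[1+ε]d
          p≤f[[1+ε]d] : ℕ→ℚ p ≤ interp f ((1ℚ + ε) * ℕ→ℚ d)
          p≤f[[1+ε]d] = subst (_≤ interp f ((1ℚ + ε) * ℕ→ℚ d)) fx≡p (interp-antitone f-antitone 0≤[1+ε]d [1+ε]d≤x)
          f[[1+ε]d]≤[1+ε]p : ℕ→ℚ order * (ℕ→ℚ (suc maxDegree) - (1ℚ + ε) * ℕ→ℚ d) ≤ (1ℚ + ε) * ℕ→ℚ p ⊎ ℕ→ℚ order ≤ (1ℚ + ε) * ℕ→ℚ p →
            interp f ((1ℚ + ε) * ℕ→ℚ d) ≤ (1ℚ + ε) * ℕ→ℚ p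
          f[[1+ε]d]≤[1+ε]p (inj₁ linear≤) = ℚₚ.≤-trans (interp≤order*[Δ+1-y] 0≤[1+ε]d [1+ε]d≤Δ+1) linear≤
          f[[1+ε]d]≤[1+ε]p (inj₂ order≤) = ℚₚ.≤-trans (interp≤order 0≤[1+ε]d) order≤

    -- d is matched with d' = 1 when p ≥ |V(G)|, and otherwise with the point x where φ_G crosses p,
    -- moved down to (1 + ε) d if x lies beyond it: there φ_G ≥ p, and the deficit slack bounds φ_G above.
    matched : ∀ {ε d p} → 0ℚ ≤ ε → 1 ℕ.≤ d → 1 ℕ.≤ p → Slack ε d p → Matched ε d p
    matched {ε} {d} {p} 0≤ε 1≤d 1≤p slack = by-order (order ℕ.≤? p)
      where
        by-position : ∀ {x} → 1ℚ ≤ x → x ≤ ℕ→ℚ (suc maxDegree) → interp f x ≡ ℕ→ℚ p → p ℕ.< order →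
          Dec (x ≤ (1ℚ + ε) * ℕ→ℚ d) → Matched ε d p
        by-position 1≤x x≤Δ+1 fx≡p _ (yes x≤[1+ε]d) = matched-at-crossing 0≤ε 1≤d slack 1≤x x≤Δ+1 fx≡p x≤[1+ε]d
        by-position 1≤x x≤Δ+1 fx≡p p<order (no x≰[1+ε]d) =
          matched-at-[1+ε]d 0≤ε 1≤d slack p<order x≤Δ+1 fx≡p (ℚₚ.<⇒≤ (ℚₚ.≰⇒> x≰[1+ε]d))
        at-crossing : ∃[ x ] 1ℚ ≤ x × x ≤ ℕ→ℚ (suc maxDegree) × interp f x ≡ ℕ→ℚ p → p ℕ.< order → Matched ε d p
        at-crossing (x , 1≤x , x≤Δ+1 , fx≡p) p<order = by-position 1≤x x≤Δ+1 fx≡p p<order (x ℚₚ.≤? (1ℚ + ε) * ℕ→ℚ d)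
        by-order : Dec (order ℕ.≤ p) → Matched ε d p
        by-order (yes order≤p) = matched-at-1 0≤ε 1≤d slack order≤p
        by-order (no order≰p) = at-crossing (crossing-point 1≤p (ℕₚ.≰⇒> order≰p)) (ℕₚ.≰⇒> order≰p)

  indicator : Bool → ℕ
  indicator b = if b then 1 else 0

  indicator≤1 : ∀ b → indicator b ℕ.≤ 1
  indicator≤1 true  = s≤s z≤n
  indicator≤1 false = z≤n

  indicator-true : ∀ {b} → T b → indicator b ≡ 1
  indicator-true {true} _ = refl

  indicator-≤ᵇ : ∀ {a b} → a ℕ.≤ b → indicator (a ≤ᵇ b) ≡ 1
  indicator-≤ᵇ a≤b = indicator-true (ℕₚ.≤⇒≤ᵇ a≤b)

  indicator-≰ᵇ : ∀ {a b} → b ℕ.< a → indicator (a ≤ᵇ b) ≡ 0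
  indicator-≰ᵇ {a} {b} b<a with a ≤ᵇ b in eq
  ... | false = refl
  ... | true  = ⊥-elim (ℕₚ.<⇒≱ b<a (ℕₚ.≤ᵇ⇒≤ a b (subst T (sym eq) _)))

  module _ {A : Set} where

    sum-map-mono : ∀ (f g : A → ℕ) xs → (∀ x → f x ℕ.≤ g x) → sum (map f xs) ℕ.≤ sum (map g xs)
    sum-map-mono f g []       f≤g = z≤n
    sum-map-mono f g (x ∷ xs) f≤g = ℕₚ.+-mono-≤ (f≤g x) (sum-map-mono f g xs f≤g)

    sum-map-≤-length : ∀ (f : A → ℕ) xs → (∀ x → f x ℕ.≤ 1) → sum (map f xs) ℕ.≤ length xs
    sum-map-≤-length f []       f≤1 = z≤n
    sum-map-≤-length f (x ∷ xs) f≤1 = ℕₚ.+-mono-≤ (f≤1 x) (sum-map-≤-length f xs f≤1)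

    sum-map-≡-length : ∀ (f : A → ℕ) xs → (∀ x → f x ≡ 1) → sum (map f xs) ≡ length xs
    sum-map-≡-length f []       f≡1 = refl
    sum-map-≡-length f (x ∷ xs) f≡1 = cong₂ ℕ._+_ (f≡1 x) (sum-map-≡-length f xs f≡1)

    sum-map-≡-0 : ∀ (f : A → ℕ) xs → (∀ x → f x ≡ 0) → sum (map f xs) ≡ 0
    sum-map-≡-0 f []       f≡0 = refl
    sum-map-≡-0 f (x ∷ xs) f≡0 = cong₂ ℕ._+_ (f≡0 x) (sum-map-≡-0 f xs f≡0)

    sum-map-≥-member : ∀ (f : A → ℕ) {xs x} → x ∈ xs → f x ℕ.≤ sum (map f xs)
    sum-map-≥-member f {x ∷ xs} (here refl) = ℕₚ.m≤m+n (f x) _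
    sum-map-≥-member f {y ∷ xs} (there x∈xs) = ℕₚ.≤-trans (sum-map-≥-member f x∈xs) (ℕₚ.m≤n+m _ (f y))

    sum-map-<-length : ∀ (f : A → ℕ) {xs x} → x ∈ xs → f x ≡ 0 → (∀ y → f y ℕ.≤ 1) → sum (map f xs) ℕ.< length xs
    sum-map-<-length f {_ ∷ xs} (here refl) fx≡0 f≤1 rewrite fx≡0 = s≤s (sum-map-≤-length f xs f≤1)
    sum-map-<-length f {y ∷ xs} (there x∈xs) fx≡0 f≤1 =
      ℕₚ.≤-trans (ℕₚ.≤-reflexive (sym (ℕₚ.+-suc (f y) _))) (ℕₚ.+-mono-≤ (f≤1 y) (sum-map-<-length f x∈xs fx≡0 f≤1))

    max-map-≥-member : ∀ (g : A → ℕ) {xs x} → x ∈ xs → g x ℕ.≤ foldr _⊔_ 0 (map g xs)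
    max-map-≥-member g {x ∷ xs} (here refl) = ℕₚ.m≤m⊔n (g x) _
    max-map-≥-member g {y ∷ xs} (there x∈xs) = ℕₚ.≤-trans (max-map-≥-member g x∈xs) (ℕₚ.m≤n⊔m (g y) _)

    max-map-lub : ∀ (g : A → ℕ) xs {b} → (∀ x → g x ℕ.≤ b) → foldr _⊔_ 0 (map g xs) ℕ.≤ b
    max-map-lub g []       g≤b = z≤n
    max-map-lub g (y ∷ xs) g≤b = ℕₚ.⊔-lub (g≤b y) (max-map-lub g xs g≤b)

    max-map-attained : ∀ (g : A → ℕ) xs {b} → 1 ℕ.≤ b → b ℕ.≤ foldr _⊔_ 0 (map g xs) → ∃[ x ] x ∈ xs × b ℕ.≤ g x
    max-map-attained g []       (s≤s z≤n) ()
    max-map-attained g (y ∷ xs) {b} 1≤b b≤max with b ℕ.≤? g y | ℕₚ.⊔-sel (g y) (foldr _⊔_ 0 (map g xs))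
    ... | yes b≤gy | _ = y , here refl , b≤gy
    ... | no b≰gy | inj₁ max≡gy = ⊥-elim (b≰gy (subst (b ℕ.≤_) max≡gy b≤max))
    ... | no _ | inj₂ max≡rest with max-map-attained g xs 1≤b (subst (b ℕ.≤_) max≡rest b≤max)
    ...   | x , x∈xs , b≤gx = x , there x∈xs , b≤gx

  length-allFin : ∀ k → length (allFin k) ≡ k
  length-allFin k = Listₚ.length-tabulate (λ i → i)

  sum-allFin-suc : ∀ k (f : Fin (suc k) → ℕ) → sum (map f (allFin (suc k))) ≡ f Fin.zero ℕ.+ sum (map (λ j → f (Fin.suc j)) (allFin k))
  sum-allFin-suc k f = cong (λ xs → f Fin.zero ℕ.+ sum xs)
    (trans (Listₚ.map-tabulate Fin.suc f) (sym (Listₚ.map-tabulate (λ i → i) (λ j → f (Fin.suc j)))))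

  deg-split : ∀ {k} (H : Graph (suc k)) i →
    deg H i ≡ indicator (adj H i Fin.zero) ℕ.+ sum (map (λ j → indicator (adj H i (Fin.suc j))) (allFin k))
  deg-split {k} H i = sum-allFin-suc k (λ j → indicator (adj H i j))

  ccdh-split : ∀ {k} (H : Graph (suc k)) t →
    ccdh H t ≡ indicator (t ≤ᵇ deg H Fin.zero) ℕ.+ sum (map (λ i → indicator (t ≤ᵇ deg H (Fin.suc i))) (allFin k))
  ccdh-split {k} H t = sum-allFin-suc k (λ i → indicator (t ≤ᵇ deg H i))

  module _ {k : ℕ} (H : Graph k) where

    ccdh≤order : ∀ t → ccdh H t ℕ.≤ k
    ccdh≤order t = subst (ccdh H t ℕ.≤_) (length-allFin k) (sum-map-≤-length _ (allFin k) (λ i → indicator≤1 (t ≤ᵇ deg H i)))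

    ccdh-antitone : ∀ {a b} → a ℕ.≤ b → ccdh H b ℕ.≤ ccdh H a
    ccdh-antitone {a} {b} a≤b = sum-map-mono _ _ (allFin k) (λ i → indicator-antitone (deg H i))
      where
        indicator-antitone : ∀ n → indicator (b ≤ᵇ n) ℕ.≤ indicator (a ≤ᵇ n)
        indicator-antitone n with b ℕ.≤? n
        ... | yes b≤n = ℕₚ.≤-reflexive (trans (indicator-≤ᵇ b≤n) (sym (indicator-≤ᵇ (ℕₚ.≤-trans a≤b b≤n))))
        ... | no b≰n = ℕₚ.≤-trans (ℕₚ.≤-reflexive (indicator-≰ᵇ (ℕₚ.≰⇒> b≰n))) z≤n

    deg≤Δ : ∀ i → deg H i ℕ.≤ Δ H
    deg≤Δ i = max-map-≥-member (deg H) (∈-allFin i)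

    deg<order : ∀ i → deg H i ℕ.< k
    deg<order i = subst (deg H i ℕ.<_) (length-allFin k)
      (sum-map-<-length _ (∈-allFin i) (cong indicator (irrefl H i)) (λ j → indicator≤1 (adj H i j)))

    Δ<order : 1 ℕ.≤ k → Δ H ℕ.< k
    Δ<order (s≤s z≤n) = s≤s (max-map-lub (deg H) (allFin _) (λ i → ℕₚ.≤-pred (deg<order i)))

    ccdh-beyond-Δ : ccdh H (suc (Δ H)) ≡ 0
    ccdh-beyond-Δ = sum-map-≡-0 _ (allFin k) (λ i → indicator-≰ᵇ (s≤s (deg≤Δ i)))

    ccdh-1 : NoIsolated H → ccdh H 1 ≡ k
    ccdh-1 noIsolated = trans (sum-map-≡-length _ (allFin k) (λ i → indicator-≤ᵇ (noIsolated i))) (length-allFin k)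

    1≤ccdh : ∀ {t} → 1 ℕ.≤ t → t ℕ.≤ Δ H → 1 ℕ.≤ ccdh H t
    1≤ccdh {t} 1≤t t≤Δ with max-map-attained (deg H) (allFin k) 1≤t t≤Δ
    ... | i , i∈V , t≤deg = ℕₚ.≤-trans (ℕₚ.≤-reflexive (sym (indicator-≤ᵇ t≤deg)))
                                        (sum-map-≥-member (λ i → indicator (t ≤ᵇ deg H i)) i∈V)

    ccdhShape : NoIsolated H → CcdhShape
    ccdhShape noIsolated = record
      { f            = ccdh H
      ; order        = k
      ; maxDegree    = Δ H
      ; f-antitone   = ccdh-antitone
      ; f≤order      = ccdh≤order
      ; f-1          = ccdh-1 noIsolated
      ; f-beyond-max = ccdh-beyond-Δ
      }

  -- Complete graphs and stars

  completeAdj : ∀ {k} → Fin k → Fin k → Bool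
  completeAdj Fin.zero    Fin.zero    = false
  completeAdj Fin.zero    (Fin.suc _) = true
  completeAdj (Fin.suc _) Fin.zero    = true
  completeAdj (Fin.suc i) (Fin.suc j) = completeAdj i j

  completeAdj-sym : ∀ {k} (i j : Fin k) → completeAdj i j ≡ completeAdj j i
  completeAdj-sym Fin.zero    Fin.zero    = refl
  completeAdj-sym Fin.zero    (Fin.suc _) = refl
  completeAdj-sym (Fin.suc _) Fin.zero    = refl
  completeAdj-sym (Fin.suc i) (Fin.suc j) = completeAdj-sym i j

  completeAdj-irrefl : ∀ {k} (i : Fin k) → completeAdj i i ≡ false
  completeAdj-irrefl Fin.zero    = refl
  completeAdj-irrefl (Fin.suc i) = completeAdj-irrefl i

  complete : ∀ m → Graph m
  complete m = record { adj = completeAdj ; sym = completeAdj-sym ; irrefl = completeAdj-irrefl }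

  deg-complete : ∀ k (i : Fin (suc k)) → deg (complete (suc k)) i ≡ k
  deg-complete k Fin.zero = trans (deg-split (complete (suc k)) Fin.zero)
    (trans (sum-map-≡-length _ (allFin k) (λ _ → refl)) (length-allFin k))
  deg-complete (suc k) (Fin.suc i) = trans (deg-split (complete (suc (suc k))) (Fin.suc i)) (cong suc (deg-complete k i))

  ccdh-complete-below : ∀ {m t} → t ℕ.< m → ccdh (complete m) t ≡ m
  ccdh-complete-below {suc k} {t} t<m = trans (sum-map-≡-length _ (allFin (suc k))
    (λ i → indicator-≤ᵇ (subst (t ℕ.≤_) (sym (deg-complete k i)) (ℕₚ.≤-pred t<m)))) (length-allFin (suc k))

  ccdh-complete-above : ∀ {m t} → m ℕ.≤ t → ccdh (complete m) t ≡ 0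
  ccdh-complete-above {zero} _ = refl
  ccdh-complete-above {suc k} m≤t = sum-map-≡-0 _ (allFin (suc k))
    (λ i → indicator-≰ᵇ (subst (ℕ._< _) (sym (deg-complete k i)) m≤t))

  complete-noIsolated : ∀ {m} → 2 ℕ.≤ m → NoIsolated (complete m)
  complete-noIsolated {1} (s≤s ())
  complete-noIsolated {suc (suc k)} _ i = subst (1 ℕ.≤_) (sym (deg-complete (suc k) i)) (s≤s z≤n)

  starAdj : ∀ {k} → Fin k → Fin k → Bool
  starAdj Fin.zero    Fin.zero    = false
  starAdj Fin.zero    (Fin.suc _) = true
  starAdj (Fin.suc _) Fin.zero    = true
  starAdj (Fin.suc _) (Fin.suc _) = false

  starAdj-sym : ∀ {k} (i j : Fin k) → starAdj i j ≡ starAdj j i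
  starAdj-sym Fin.zero    Fin.zero    = refl
  starAdj-sym Fin.zero    (Fin.suc _) = refl
  starAdj-sym (Fin.suc _) Fin.zero    = refl
  starAdj-sym (Fin.suc _) (Fin.suc _) = refl

  starAdj-irrefl : ∀ {k} (i : Fin k) → starAdj i i ≡ false
  starAdj-irrefl Fin.zero    = refl
  starAdj-irrefl (Fin.suc _) = refl

  star : ∀ k → Graph (suc k)
  star k = record { adj = starAdj ; sym = starAdj-sym ; irrefl = starAdj-irrefl }

  deg-star-centre : ∀ k → deg (star k) Fin.zero ≡ k
  deg-star-centre k = trans (deg-split (star k) Fin.zero) (trans (sum-map-≡-length _ (allFin k) (λ _ → refl)) (length-allFin k))

  deg-star-leaf : ∀ k (i : Fin k) → deg (star k) (Fin.suc i) ≡ 1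
  deg-star-leaf k i = trans (deg-split (star k) (Fin.suc i)) (cong suc (sum-map-≡-0 _ (allFin k) (λ _ → refl)))

  star-noIsolated : ∀ k → NoIsolated (star (suc k))
  star-noIsolated k Fin.zero    = subst (1 ℕ.≤_) (sym (deg-star-centre (suc k))) (s≤s z≤n)
  star-noIsolated k (Fin.suc i) = subst (1 ℕ.≤_) (sym (deg-star-leaf (suc k) i)) (s≤s z≤n)

  ccdh-star-2 : ∀ k → ccdh (star (suc (suc k))) 2 ≡ 1
  ccdh-star-2 k = trans (ccdh-split (star (suc (suc k))) 2)
    (cong₂ ℕ._+_ (indicator-≤ᵇ (subst (2 ℕ.≤_) (sym (deg-star-centre (suc (suc k)))) (s≤s (s≤s z≤n))))
                 (sum-map-≡-0 _ (allFin (suc (suc k))) (λ i → indicator-≰ᵇ (subst (ℕ._< 2) (sym (deg-star-leaf (suc (suc k)) i)) (s≤s (s≤s z≤n))))))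

  2≤Δ-star : ∀ k → 2 ℕ.≤ Δ (star (suc (suc k)))
  2≤Δ-star k = ℕₚ.≤-trans (subst (2 ℕ.≤_) (sym (deg-star-centre (suc (suc k)))) (s≤s (s≤s z≤n))) (deg≤Δ (star (suc (suc k))) Fin.zero)

  -- L₂ m and L₃ m are the values 1 + ε of the two cases of the theorem.
  L₂ : ℕ → ℚ
  L₂ m = + m / 2

  L₃ : ℕ → ℚ
  L₃ m = + (m ℕ.* m) / suc (2 ℕ.* m)

  2*L₂≡m : ∀ m → ℕ→ℚ 2 * L₂ m ≡ ℕ→ℚ m
  2*L₂≡m m = trans (ℚₚ.*-comm (ℕ→ℚ 2) (L₂ m)) (/-*-cancel m 1)

  ≤-byDoubledDifference : ∀ {p q} (s : ℚ) → ℕ→ℚ 2 * (q - p) ≡ s → 0ℚ ≤ s → p ≤ q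
  ≤-byDoubledDifference s = ≤-byScaledDifference s (0<ℕ→ℚ-suc 1)

  0≤L₂-1 : ∀ {m} → 2 ℕ.≤ m → 0ℚ ≤ L₂ m - 1ℚ
  0≤L₂-1 {m} 2≤m = ≤-byDoubledDifference (ℕ→ℚ (m ℕ.∸ 2)) (begin
    ℕ→ℚ 2 * ((L₂ m - 1ℚ) - 0ℚ)   ≡⟨ solve 1 (λ L → con (ℕ→ℚ 2) :* ((L :- con 1ℚ) :- con 0ℚ) := con (ℕ→ℚ 2) :* L :- con (ℕ→ℚ 2)) refl (L₂ m) ⟩
    ℕ→ℚ 2 * L₂ m - ℕ→ℚ 2         ≡⟨ cong (_- ℕ→ℚ 2) (2*L₂≡m m) ⟩
    ℕ→ℚ m - ℕ→ℚ 2                ≡⟨ ℕ→ℚ-∸ 2≤m ⟨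
    ℕ→ℚ (m ℕ.∸ 2)                ∎) (0≤ℕ→ℚ (m ℕ.∸ 2))
    where open ≡-Reasoning

  1≤L₂ : ∀ {m} → 2 ℕ.≤ m → 1ℚ ≤ L₂ m
  1≤L₂ {m} 2≤m = subst (1ℚ ≤_) (1+[L-1]≡L (L₂ m)) (p≤p+q (0≤L₂-1 2≤m))

  [L₂-1]*2≡m-2 : ∀ m → (L₂ m - 1ℚ) * ℕ→ℚ 2 ≡ ℕ→ℚ m - ℕ→ℚ 2
  [L₂-1]*2≡m-2 m = begin
    (L₂ m - 1ℚ) * ℕ→ℚ 2     ≡⟨ solve 1 (λ L → (L :- con 1ℚ) :* con (ℕ→ℚ 2) := con (ℕ→ℚ 2) :* L :- con (ℕ→ℚ 2)) refl (L₂ m) ⟩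
    ℕ→ℚ 2 * L₂ m - ℕ→ℚ 2    ≡⟨ cong (_- ℕ→ℚ 2) (2*L₂≡m m) ⟩
    ℕ→ℚ m - ℕ→ℚ 2           ∎
    where open ≡-Reasoning

  L₂-1≤m-2 : ∀ {m} → 2 ℕ.≤ m → L₂ m - 1ℚ ≤ ℕ→ℚ m - ℕ→ℚ 2
  L₂-1≤m-2 {m} 2≤m = ≤-byDoubledDifference (ℕ→ℚ m - ℕ→ℚ 2) (begin
    ℕ→ℚ 2 * ((ℕ→ℚ m - ℕ→ℚ 2) - (L₂ m - 1ℚ))
      ≡⟨ solve 2 (λ M L → con (ℕ→ℚ 2) :* ((M :- con (ℕ→ℚ 2)) :- (L :- con 1ℚ)) := con (ℕ→ℚ 2) :* M :- con (ℕ→ℚ 2) :* L :- con (ℕ→ℚ 2)) refl (ℕ→ℚ m) (L₂ m) ⟩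
    ℕ→ℚ 2 * ℕ→ℚ m - ℕ→ℚ 2 * L₂ m - ℕ→ℚ 2
      ≡⟨ cong (λ z → ℕ→ℚ 2 * ℕ→ℚ m - z - ℕ→ℚ 2) (2*L₂≡m m) ⟩
    ℕ→ℚ 2 * ℕ→ℚ m - ℕ→ℚ m - ℕ→ℚ 2
      ≡⟨ solve 1 (λ M → con (ℕ→ℚ 2) :* M :- M :- con (ℕ→ℚ 2) := M :- con (ℕ→ℚ 2)) refl (ℕ→ℚ m) ⟩
    ℕ→ℚ m - ℕ→ℚ 2 ∎)
    (p≤q⇒0≤q-p (ℕ→ℚ-mono-≤ 2≤m))
    where open ≡-Reasoning

  degree-slack₂ : ∀ {m d} → 1 ℕ.≤ d → d ℕ.< m → ℕ→ℚ d - 1ℚ ≤ (L₂ m - 1ℚ) * ℕ→ℚ d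
  degree-slack₂ {m} {1} _ 1<m = ℚₚ.≤-trans (ℚₚ.≤-reflexive (ℚₚ.+-inverseʳ 1ℚ)) (0≤* (0≤L₂-1 1<m) (0≤ℕ→ℚ 1))
  degree-slack₂ {m} {suc (suc b)} _ d<m = ≤-byDoubledDifference (B + B * B + C * (ℕ→ℚ 2 + B)) (begin
    ℕ→ℚ 2 * ((L₂ m - 1ℚ) * D - (D - 1ℚ))
      ≡⟨ solve 2 (λ L D → con (ℕ→ℚ 2) :* ((L :- con 1ℚ) :* D :- (D :- con 1ℚ)) := (con (ℕ→ℚ 2) :* L) :* D :- con (ℕ→ℚ 4) :* D :+ con (ℕ→ℚ 2)) refl (L₂ m) D ⟩
    (ℕ→ℚ 2 * L₂ m) * D - ℕ→ℚ 4 * D + ℕ→ℚ 2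
      ≡⟨ cong₂ (λ u v → u * v - ℕ→ℚ 4 * v + ℕ→ℚ 2) (trans (2*L₂≡m m) (trans (ℕ→ℚ-split d<m) (cong (_+ C) (ℕ→ℚ-+ 3 b)))) (ℕ→ℚ-+ 2 b) ⟩
    ((ℕ→ℚ 3 + B) + C) * (ℕ→ℚ 2 + B) - ℕ→ℚ 4 * (ℕ→ℚ 2 + B) + ℕ→ℚ 2
      ≡⟨ solve 2 (λ B C → ((con (ℕ→ℚ 3) :+ B) :+ C) :* (con (ℕ→ℚ 2) :+ B) :- con (ℕ→ℚ 4) :* (con (ℕ→ℚ 2) :+ B) :+ con (ℕ→ℚ 2)
                          := B :+ B :* B :+ C :* (con (ℕ→ℚ 2) :+ B)) refl B C ⟩
    B + B * B + C * (ℕ→ℚ 2 + B) ∎)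
    (0≤+ (0≤+ (0≤ℕ→ℚ b) (0≤* (0≤ℕ→ℚ b) (0≤ℕ→ℚ b))) (0≤* (0≤ℕ→ℚ (m ℕ.∸ suc (suc (suc b)))) (0≤+ (0≤ℕ→ℚ 2) (0≤ℕ→ℚ b))))
    where
      open ≡-Reasoning
      B = ℕ→ℚ b
      C = ℕ→ℚ (m ℕ.∸ suc (suc (suc b)))
      D = ℕ→ℚ (suc (suc b))

  surplus-slack₂ : ∀ {m p} → 2 ℕ.≤ p → p ℕ.≤ m → ℕ→ℚ p - ℕ→ℚ 2 ≤ (L₂ m - 1ℚ) * ℕ→ℚ p
  surplus-slack₂ {m} {p} 2≤p p≤m = ≤-byDoubledDifference (B * B + C * (ℕ→ℚ 2 + B)) (begin
    ℕ→ℚ 2 * ((L₂ m - 1ℚ) * P - (P - ℕ→ℚ 2))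
      ≡⟨ solve 2 (λ L P → con (ℕ→ℚ 2) :* ((L :- con 1ℚ) :* P :- (P :- con (ℕ→ℚ 2))) := (con (ℕ→ℚ 2) :* L) :* P :- con (ℕ→ℚ 4) :* P :+ con (ℕ→ℚ 4)) refl (L₂ m) P ⟩
    (ℕ→ℚ 2 * L₂ m) * P - ℕ→ℚ 4 * P + ℕ→ℚ 4
      ≡⟨ cong₂ (λ u v → u * v - ℕ→ℚ 4 * v + ℕ→ℚ 4) (trans (2*L₂≡m m) (trans (ℕ→ℚ-split p≤m) (cong (_+ C) P≡2+B))) P≡2+B ⟩
    ((ℕ→ℚ 2 + B) + C) * (ℕ→ℚ 2 + B) - ℕ→ℚ 4 * (ℕ→ℚ 2 + B) + ℕ→ℚ 4
      ≡⟨ solve 2 (λ B C → ((con (ℕ→ℚ 2) :+ B) :+ C) :* (con (ℕ→ℚ 2) :+ B) :- con (ℕ→ℚ 4) :* (con (ℕ→ℚ 2) :+ B) :+ con (ℕ→ℚ 4)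
                          := B :* B :+ C :* (con (ℕ→ℚ 2) :+ B)) refl B C ⟩
    B * B + C * (ℕ→ℚ 2 + B) ∎)
    (0≤+ (0≤* (0≤ℕ→ℚ (p ℕ.∸ 2)) (0≤ℕ→ℚ (p ℕ.∸ 2))) (0≤* (0≤ℕ→ℚ (m ℕ.∸ p)) (0≤+ (0≤ℕ→ℚ 2) (0≤ℕ→ℚ (p ℕ.∸ 2)))))
    where
      open ≡-Reasoning
      B = ℕ→ℚ (p ℕ.∸ 2)
      C = ℕ→ℚ (m ℕ.∸ p)
      P = ℕ→ℚ p
      P≡2+B : P ≡ ℕ→ℚ 2 + B
      P≡2+B = ℕ→ℚ-split 2≤p

  deficit-slack₂ : ∀ {m S d} p → 2 ℕ.≤ m → S ℕ.≤ 2 → 2 ℕ.≤ d → ℕ→ℚ 2 * (ℕ→ℚ S - L₂ m * ℕ→ℚ d) ≤ L₂ m * ℕ→ℚ p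
  deficit-slack₂ {m} {S} {d} p 2≤m S≤2 2≤d = ℚₚ.≤-trans
    (K*[S-y]≤M*[M-z] (0≤ℕ→ℚ 2) ℚₚ.≤-refl (ℕ→ℚ-mono-≤ S≤2) 2≤L₂d (≤-byComputation _))
    (ℚₚ.≤-trans (≤-byComputation _) (0≤* (ℚₚ.≤-trans (0≤ℕ→ℚ 1) (1≤L₂ 2≤m)) (0≤ℕ→ℚ p)))
    where
      2≤L₂d : ℕ→ℚ 2 ≤ L₂ m * ℕ→ℚ d
      2≤L₂d = subst (_≤ L₂ m * ℕ→ℚ d) (ℚₚ.*-identityˡ (ℕ→ℚ 2))
                (*-mono-≤-nonNeg (0≤ℕ→ℚ 1) (1≤L₂ 2≤m) (0≤ℕ→ℚ 2) (ℕ→ℚ-mono-≤ 2≤d))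

  module _ (m : ℕ) where
    private
      M = ℕ→ℚ m
      E = ℕ→ℚ (suc (2 ℕ.* m))
      L = L₃ m
      0<E = 0<ℕ→ℚ-suc (2 ℕ.* m)

    L₃*[2m+1]≡m*m : L₃ m * ℕ→ℚ (suc (2 ℕ.* m)) ≡ ℕ→ℚ m * ℕ→ℚ m
    L₃*[2m+1]≡m*m = trans (/-*-cancel (m ℕ.* m) (2 ℕ.* m)) (ℕ→ℚ-* m m)

    [2m+1]≡1+[m+m] : ℕ→ℚ (suc (2 ℕ.* m)) ≡ 1ℚ + (ℕ→ℚ m + ℕ→ℚ m)
    [2m+1]≡1+[m+m] = trans (ℕ→ℚ-suc (2 ℕ.* m)) (trans (cong (λ k → 1ℚ + ℕ→ℚ (m ℕ.+ k)) (ℕₚ.+-identityʳ m)) (cong (λ z → 1ℚ + z) (ℕ→ℚ-+ m m)))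

    -- The identity behind the value L₃ m: the deficit bound is tight for d = 2 and p = 1.
    m*[m-2*L₃]≡L₃ : ℕ→ℚ m * (ℕ→ℚ m - ℕ→ℚ 2 * L₃ m) ≡ L₃ m
    m*[m-2*L₃]≡L₃ = begin
      M * (M - ℕ→ℚ 2 * L)         ≡⟨ solve 2 (λ M L → M :* (M :- con (ℕ→ℚ 2) :* L) := M :* M :- (M :+ M) :* L) refl M L ⟩
      M * M - (M + M) * L          ≡⟨ cong (λ z → z - (M + M) * L) (sym L₃*[2m+1]≡m*m) ⟩
      L * E - (M + M) * L          ≡⟨ cong (λ z → L * z - (M + M) * L) [2m+1]≡1+[m+m] ⟩
      L * (1ℚ + (M + M)) - (M + M) * L ≡⟨ solve 2 (λ M L → L :* (con 1ℚ :+ (M :+ M)) :- (M :+ M) :* L := L) refl M L ⟩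
      L                            ∎
      where open ≡-Reasoning

    ≤-by[2m+1]-scaledDifference : ∀ {p q} (s : ℚ) → ℕ→ℚ (suc (2 ℕ.* m)) * (q - p) ≡ s → 0ℚ ≤ s → p ≤ q
    ≤-by[2m+1]-scaledDifference s = ≤-byScaledDifference s 0<E

    L₃≤m : L₃ m ≤ ℕ→ℚ m
    L₃≤m = ≤-by[2m+1]-scaledDifference (M + M * M) (begin
      E * (M - L)              ≡⟨ solve 3 (λ E M L → E :* (M :- L) := E :* M :- L :* E) refl E M L ⟩
      E * M - L * E            ≡⟨ cong₂ (λ u v → u * M - v) [2m+1]≡1+[m+m] L₃*[2m+1]≡m*m ⟩
      (1ℚ + (M + M)) * M - M * M ≡⟨ solve 1 (λ M → (con 1ℚ :+ (M :+ M)) :* M :- M :* M := M :+ M :* M) refl M ⟩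
      M + M * M                ∎)
      (0≤+ (0≤ℕ→ℚ m) (0≤* (0≤ℕ→ℚ m) (0≤ℕ→ℚ m)))
      where open ≡-Reasoning

    m≤3*L₃ : 1 ℕ.≤ m → ℕ→ℚ m ≤ ℕ→ℚ 3 * L₃ m
    m≤3*L₃ 1≤m = ≤-by[2m+1]-scaledDifference (A + A * A) (begin
      E * (ℕ→ℚ 3 * L - M)       ≡⟨ solve 3 (λ E M L → E :* (con (ℕ→ℚ 3) :* L :- M) := con (ℕ→ℚ 3) :* (L :* E) :- E :* M) refl E M L ⟩
      ℕ→ℚ 3 * (L * E) - E * M   ≡⟨ cong₂ (λ u v → ℕ→ℚ 3 * u - v * M) L₃*[2m+1]≡m*m [2m+1]≡1+[m+m] ⟩
      ℕ→ℚ 3 * (M * M) - (1ℚ + (M + M)) * M ≡⟨ cong (λ z → ℕ→ℚ 3 * (z * z) - (1ℚ + (z + z)) * z) (ℕ→ℚ-split 1≤m) ⟩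
      ℕ→ℚ 3 * ((1ℚ + A) * (1ℚ + A)) - (1ℚ + ((1ℚ + A) + (1ℚ + A))) * (1ℚ + A)
        ≡⟨ solve 1 (λ A → con (ℕ→ℚ 3) :* ((con 1ℚ :+ A) :* (con 1ℚ :+ A)) :- (con 1ℚ :+ ((con 1ℚ :+ A) :+ (con 1ℚ :+ A))) :* (con 1ℚ :+ A) := A :+ A :* A) refl A ⟩
      A + A * A                 ∎)
      (0≤+ (0≤ℕ→ℚ (m ℕ.∸ 1)) (0≤* (0≤ℕ→ℚ (m ℕ.∸ 1)) (0≤ℕ→ℚ (m ℕ.∸ 1))))
      where
        open ≡-Reasoning
        A = ℕ→ℚ (m ℕ.∸ 1)

    0≤L₃-1 : 3 ℕ.≤ m → 0ℚ ≤ L₃ m - 1ℚ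
    0≤L₃-1 3≤m = ≤-by[2m+1]-scaledDifference (A * A + (ℕ→ℚ 4 * A + ℕ→ℚ 2)) (begin
      E * ((L - 1ℚ) - 0ℚ)      ≡⟨ solve 2 (λ E L → E :* ((L :- con 1ℚ) :- con 0ℚ) := L :* E :- E) refl E L ⟩
      L * E - E                ≡⟨ cong₂ _-_ L₃*[2m+1]≡m*m [2m+1]≡1+[m+m] ⟩
      M * M - (1ℚ + (M + M))   ≡⟨ cong (λ z → z * z - (1ℚ + (z + z))) (ℕ→ℚ-split 3≤m) ⟩
      (ℕ→ℚ 3 + A) * (ℕ→ℚ 3 + A) - (1ℚ + ((ℕ→ℚ 3 + A) + (ℕ→ℚ 3 + A)))
        ≡⟨ solve 1 (λ A → (con (ℕ→ℚ 3) :+ A) :* (con (ℕ→ℚ 3) :+ A) :- (con 1ℚ :+ ((con (ℕ→ℚ 3) :+ A) :+ (con (ℕ→ℚ 3) :+ A)))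
                         := A :* A :+ (con (ℕ→ℚ 4) :* A :+ con (ℕ→ℚ 2))) refl A ⟩
      A * A + (ℕ→ℚ 4 * A + ℕ→ℚ 2) ∎)
      (0≤+ (0≤* (0≤ℕ→ℚ (m ℕ.∸ 3)) (0≤ℕ→ℚ (m ℕ.∸ 3))) (0≤+ (0≤* (0≤ℕ→ℚ 4) (0≤ℕ→ℚ (m ℕ.∸ 3))) (0≤ℕ→ℚ 2)))
      where
        open ≡-Reasoning
        A = ℕ→ℚ (m ℕ.∸ 3)

    1≤L₃-1 : 5 ℕ.≤ m → 1ℚ ≤ L₃ m - 1ℚ
    1≤L₃-1 5≤m = ≤-by[2m+1]-scaledDifference (A * A + (ℕ→ℚ 6 * A + ℕ→ℚ 3)) (begin
      E * ((L - 1ℚ) - 1ℚ)      ≡⟨ solve 2 (λ E L → E :* ((L :- con 1ℚ) :- con 1ℚ) := L :* E :- (E :+ E)) refl E L ⟩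
      L * E - (E + E)          ≡⟨ cong₂ (λ u v → u - (v + v)) L₃*[2m+1]≡m*m [2m+1]≡1+[m+m] ⟩
      M * M - ((1ℚ + (M + M)) + (1ℚ + (M + M))) ≡⟨ cong (λ z → z * z - ((1ℚ + (z + z)) + (1ℚ + (z + z)))) (ℕ→ℚ-split 5≤m) ⟩
      (ℕ→ℚ 5 + A) * (ℕ→ℚ 5 + A) - ((1ℚ + ((ℕ→ℚ 5 + A) + (ℕ→ℚ 5 + A))) + (1ℚ + ((ℕ→ℚ 5 + A) + (ℕ→ℚ 5 + A))))
        ≡⟨ solve 1 (λ A → (con (ℕ→ℚ 5) :+ A) :* (con (ℕ→ℚ 5) :+ A) :- ((con 1ℚ :+ ((con (ℕ→ℚ 5) :+ A) :+ (con (ℕ→ℚ 5) :+ A))) :+ (con 1ℚ :+ ((con (ℕ→ℚ 5) :+ A) :+ (con (ℕ→ℚ 5) :+ A))))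
                         := A :* A :+ (con (ℕ→ℚ 6) :* A :+ con (ℕ→ℚ 3))) refl A ⟩
      A * A + (ℕ→ℚ 6 * A + ℕ→ℚ 3) ∎)
      (0≤+ (0≤* (0≤ℕ→ℚ (m ℕ.∸ 5)) (0≤ℕ→ℚ (m ℕ.∸ 5))) (0≤+ (0≤* (0≤ℕ→ℚ 6) (0≤ℕ→ℚ (m ℕ.∸ 5))) (0≤ℕ→ℚ 3)))
      where
        open ≡-Reasoning
        A = ℕ→ℚ (m ℕ.∸ 5)

  1≤L₃ : ∀ {m} → 3 ℕ.≤ m → 1ℚ ≤ L₃ m
  1≤L₃ {m} 3≤m = subst (1ℚ ≤_) (1+[L-1]≡L (L₃ m)) (p≤p+q (0≤L₃-1 m 3≤m))

  -- m = 4 is the only case with L₃ m < 2, and it is checked by computation.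
  degree-slack₃ : ∀ {m d} → 4 ℕ.≤ m → 1 ℕ.≤ d → d ℕ.< m → ℕ→ℚ d - 1ℚ ≤ (L₃ m - 1ℚ) * ℕ→ℚ d
  degree-slack₃ {0} () _ _
  degree-slack₃ {1} (s≤s ()) _ _
  degree-slack₃ {2} (s≤s (s≤s ())) _ _
  degree-slack₃ {3} (s≤s (s≤s (s≤s ()))) _ _
  degree-slack₃ {4} {1} _ _ _ = ≤-byComputation _
  degree-slack₃ {4} {2} _ _ _ = ≤-byComputation _
  degree-slack₃ {4} {3} _ _ _ = ≤-byComputation _
  degree-slack₃ {4} {suc (suc (suc (suc _)))} _ _ (s≤s (s≤s (s≤s (s≤s ()))))
  degree-slack₃ {suc (suc (suc (suc (suc k))))} {d} _ _ _ =
    1≤ε⇒p-q≤ε*p (1≤L₃-1 (5 ℕ.+ k) (s≤s (s≤s (s≤s (s≤s (s≤s z≤n)))))) (0≤ℕ→ℚ d) (0≤ℕ→ℚ 1)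

  surplus-slack₃ : ∀ {m K p} → 4 ℕ.≤ m → 3 ℕ.≤ K → p ℕ.≤ m → ℕ→ℚ p - ℕ→ℚ K ≤ (L₃ m - 1ℚ) * ℕ→ℚ p
  surplus-slack₃ {0} () _ _
  surplus-slack₃ {1} (s≤s ()) _ _
  surplus-slack₃ {2} (s≤s (s≤s ())) _ _
  surplus-slack₃ {3} (s≤s (s≤s (s≤s ()))) _ _
  surplus-slack₃ {4} {K} {p} _ 3≤K p≤4 = ℚₚ.≤-trans (ℚₚ.+-monoʳ-≤ (ℕ→ℚ p) (ℚₚ.neg-antimono-≤ (ℕ→ℚ-mono-≤ 3≤K))) (at p p≤4)
    where
      at : ∀ p → p ℕ.≤ 4 → ℕ→ℚ p - ℕ→ℚ 3 ≤ (L₃ 4 - 1ℚ) * ℕ→ℚ p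
      at 0 _ = ≤-byComputation _
      at 1 _ = ≤-byComputation _
      at 2 _ = ≤-byComputation _
      at 3 _ = ≤-byComputation _
      at 4 _ = ≤-byComputation _
      at (suc (suc (suc (suc (suc _))))) (s≤s (s≤s (s≤s (s≤s ()))))
  surplus-slack₃ {suc (suc (suc (suc (suc k))))} {K} {p} _ _ _ =
    1≤ε⇒p-q≤ε*p (1≤L₃-1 (5 ℕ.+ k) (s≤s (s≤s (s≤s (s≤s (s≤s z≤n)))))) (0≤ℕ→ℚ p) (0≤ℕ→ℚ K)

  deficit-slack₃ : ∀ {m K S d p} → 3 ℕ.≤ m → K ℕ.≤ m → S ℕ.≤ m → 1 ℕ.≤ d → 1 ℕ.≤ p → (d ≡ 1 → 3 ℕ.≤ p) →
    ℕ→ℚ K * (ℕ→ℚ S - L₃ m * ℕ→ℚ d) ≤ L₃ m * ℕ→ℚ p ⊎ ℕ→ℚ K ≤ L₃ m * ℕ→ℚ p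
  deficit-slack₃ {m} {K} {S} {1} {p} 3≤m K≤m _ _ _ 3≤p = inj₂ (begin
    ℕ→ℚ K          ≤⟨ ℕ→ℚ-mono-≤ K≤m ⟩
    ℕ→ℚ m          ≤⟨ m≤3*L₃ m (ℕₚ.≤-trans (s≤s z≤n) 3≤m) ⟩
    ℕ→ℚ 3 * L₃ m   ≡⟨ ℚₚ.*-comm (ℕ→ℚ 3) (L₃ m) ⟩
    L₃ m * ℕ→ℚ 3   ≤⟨ ℚₚ.*-monoˡ-≤-nonNeg (L₃ m) {{ℚ.nonNegative 0≤L₃}} (ℕ→ℚ-mono-≤ (3≤p refl)) ⟩
    L₃ m * ℕ→ℚ p   ∎)
    where
      open ℚₚ.≤-Reasoning
      0≤L₃ = ℚₚ.≤-trans (0≤ℕ→ℚ 1) (1≤L₃ 3≤m)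
  deficit-slack₃ {m} {K} {S} {suc (suc d)} {p} 3≤m K≤m S≤m _ 1≤p _ = inj₁ (begin
    ℕ→ℚ K * (ℕ→ℚ S - L₃ m * D)         ≤⟨ K*[S-y]≤M*[M-z] (0≤ℕ→ℚ K) (ℕ→ℚ-mono-≤ K≤m) (ℕ→ℚ-mono-≤ S≤m) 2L≤Ld (subst (0ℚ ≤_) (sym (m*[m-2*L₃]≡L₃ m)) 0≤L₃) ⟩
    ℕ→ℚ m * (ℕ→ℚ m - ℕ→ℚ 2 * L₃ m)    ≡⟨ m*[m-2*L₃]≡L₃ m ⟩
    L₃ m                               ≡⟨ ℚₚ.*-identityʳ (L₃ m) ⟨
    L₃ m * 1ℚ                          ≤⟨ ℚₚ.*-monoˡ-≤-nonNeg (L₃ m) {{ℚ.nonNegative 0≤L₃}} (ℕ→ℚ-mono-≤ 1≤p) ⟩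
    L₃ m * ℕ→ℚ p                       ∎)
    where
      open ℚₚ.≤-Reasoning
      D = ℕ→ℚ (suc (suc d))
      0≤L₃ = ℚₚ.≤-trans (0≤ℕ→ℚ 1) (1≤L₃ 3≤m)
      2L≤Ld : ℕ→ℚ 2 * L₃ m ≤ L₃ m * D
      2L≤Ld = subst (_≤ L₃ m * D) (ℚₚ.*-comm (L₃ m) (ℕ→ℚ 2))
                (ℚₚ.*-monoˡ-≤-nonNeg (L₃ m) {{ℚ.nonNegative 0≤L₃}} (ℕ→ℚ-mono-≤ {2} {suc (suc d)} (s≤s (s≤s z≤n))))

  -- Upper bounds

  φ-ℕ : ∀ {k} (H : Graph k) i → φ H (ℕ→ℚ i) ≡ ℕ→ℚ (ccdh H i)
  φ-ℕ H = interp-ℕ (ccdh H)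

  φ≡chord-⌊⌋ₙ : ∀ {k} (H : Graph k) y → φ H y ≡ chord (ccdh H) ⌊ y ⌋ₙ y
  φ≡chord-⌊⌋ₙ H = interp≡chord-⌊⌋ₙ (ccdh H)

  ccdh[⌊y⌋+1]≤φ : ∀ {k} (H : Graph k) {y} → 0ℚ ≤ y → ℕ→ℚ (ccdh H (suc ⌊ y ⌋ₙ)) ≤ φ H y
  ccdh[⌊y⌋+1]≤φ H = t[⌊x⌋+1]≤interp (ccdh-antitone H)

  admissible : ∀ {n m} (F : Graph n) (G : Graph m) (noIsolated : NoIsolated G) {ε} → 0ℚ ≤ ε →
    (∀ {d} → 1 ℕ.≤ d → d ℕ.≤ Δ F → Slack (ccdhShape G noIsolated) ε d (ccdh F d)) → RHrAdmissible F G ε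
  admissible F G noIsolated {ε} 0≤ε slack = 0≤ε , λ d 1≤d d≤Δ →
    subst (λ z → ∃ λ d' → 1ℚ ≤ d' × d' ≤ ℕ→ℚ (suc (Δ G)) × ∣ ℕ→ℚ d - d' ∣ ≤ ε * ℕ→ℚ d × ∣ z - φ G d' ∣ ≤ ε * z)
          (sym (φ-ℕ F d))
          (matched (ccdhShape G noIsolated) 0≤ε 1≤d (1≤ccdh F 1≤d d≤Δ) (slack 1≤d d≤Δ))

  deficit-via-L : ∀ K S d p L → ℕ→ℚ K * (ℕ→ℚ S - L * ℕ→ℚ d) ≤ L * ℕ→ℚ p ⊎ ℕ→ℚ K ≤ L * ℕ→ℚ p →
    ℕ→ℚ K * (ℕ→ℚ S - (1ℚ + (L - 1ℚ)) * ℕ→ℚ d) ≤ (1ℚ + (L - 1ℚ)) * ℕ→ℚ p ⊎ ℕ→ℚ K ≤ (1ℚ + (L - 1ℚ)) * ℕ→ℚ p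
  deficit-via-L K S d p L = subst (λ L → ℕ→ℚ K * (ℕ→ℚ S - L * ℕ→ℚ d) ≤ L * ℕ→ℚ p ⊎ ℕ→ℚ K ≤ L * ℕ→ℚ p) (sym (1+[L-1]≡L L))

  rh-bound₂ : ∀ {m} → 2 ℕ.≤ m → (F : Graph 2) (G : Graph m) → NoIsolated F → NoIsolated G → RHLe F G (L₂ m - 1ℚ)
  rh-bound₂ {m} 2≤m F G noIsolatedF noIsolatedG =
    admissible F G noIsolatedG 0≤ε slack-FG , admissible G F noIsolatedF 0≤ε slack-GF
    where
      0≤ε = 0≤L₂-1 2≤m
      ΔF≤1 : Δ F ℕ.≤ 1
      ΔF≤1 = ℕₚ.≤-pred (Δ<order F (s≤s z≤n))

      slack-FG : ∀ {d} → 1 ℕ.≤ d → d ℕ.≤ Δ F → Slack (ccdhShape G noIsolatedG) (L₂ m - 1ℚ) d (ccdh F d)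
      slack-FG {d} 1≤d d≤Δ = record
        { degree-slack  = degree-slack₂ 1≤d (ℕₚ.<-≤-trans (s≤s (ℕₚ.≤-trans d≤Δ ΔF≤1)) 2≤m)
        ; surplus-slack = λ _ → p≤q⇒p-q≤ε*p 0≤ε (0≤ℕ→ℚ (ccdh F d)) (ℕ→ℚ-mono-≤ (ℕₚ.≤-trans (ccdh≤order F d) 2≤m))
        ; deficit-slack = λ _ → inj₂ (ℚₚ.≤-reflexive (sym (begin
            (1ℚ + (L₂ m - 1ℚ)) * ℕ→ℚ (ccdh F d)  ≡⟨ cong₂ (λ L p → L * ℕ→ℚ p) (1+[L-1]≡L (L₂ m)) f[d]≡2 ⟩
            L₂ m * ℕ→ℚ 2                          ≡⟨ ℚₚ.*-comm (L₂ m) (ℕ→ℚ 2) ⟩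
            ℕ→ℚ 2 * L₂ m                          ≡⟨ 2*L₂≡m m ⟩
            ℕ→ℚ m                                 ∎)))
        }
        where
          open ≡-Reasoning
          f[d]≡2 : ccdh F d ≡ 2
          f[d]≡2 = trans (cong (ccdh F) (ℕₚ.≤-antisym (ℕₚ.≤-trans d≤Δ ΔF≤1) 1≤d)) (ccdh-1 F noIsolatedF)

      2≤d : ∀ {d} → 1 ℕ.≤ d → ccdh G d ℕ.< 2 → 2 ℕ.≤ d
      2≤d {suc (suc _)} _ _ = s≤s (s≤s z≤n)
      2≤d {suc zero} _ p<2 = ⊥-elim (ℕₚ.<⇒≱ p<2 (subst (2 ℕ.≤_) (sym (ccdh-1 G noIsolatedG)) 2≤m))

      slack-GF : ∀ {d} → 1 ℕ.≤ d → d ℕ.≤ Δ G → Slack (ccdhShape F noIsolatedF) (L₂ m - 1ℚ) d (ccdh G d)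
      slack-GF {d} 1≤d d≤Δ = record
        { degree-slack  = degree-slack₂ 1≤d (ℕₚ.≤-<-trans d≤Δ (Δ<order G (ℕₚ.≤-trans (s≤s z≤n) 2≤m)))
        ; surplus-slack = λ 2≤p → surplus-slack₂ 2≤p (ccdh≤order G d)
        ; deficit-slack = λ p<2 → deficit-via-L 2 (suc (Δ F)) d (ccdh G d) (L₂ m)
            (inj₁ (deficit-slack₂ (ccdh G d) 2≤m (Δ<order F (s≤s z≤n)) (2≤d 1≤d p<2)))
        }

  rh-bound₃ : ∀ {n m} → 3 ℕ.≤ n → n ℕ.≤ m → 4 ℕ.≤ m → (F : Graph n) (G : Graph m) → NoIsolated F → NoIsolated G →
    RHLe F G (L₃ m - 1ℚ)
  rh-bound₃ {n} {m} 3≤n n≤m 4≤m F G noIsolatedF noIsolatedG =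
    admissible F G noIsolatedG 0≤ε slack-FG , admissible G F noIsolatedF 0≤ε slack-GF
    where
      3≤m = ℕₚ.≤-trans 3≤n n≤m
      1≤n = ℕₚ.≤-trans (s≤s z≤n) 3≤n
      1≤m = ℕₚ.≤-trans (s≤s z≤n) 3≤m
      0≤ε = 0≤L₃-1 m 3≤m

      slack-FG : ∀ {d} → 1 ℕ.≤ d → d ℕ.≤ Δ F → Slack (ccdhShape G noIsolatedG) (L₃ m - 1ℚ) d (ccdh F d)
      slack-FG {d} 1≤d d≤Δ = record
        { degree-slack  = degree-slack₃ 4≤m 1≤d (ℕₚ.<-≤-trans (ℕₚ.≤-<-trans d≤Δ (Δ<order F 1≤n)) n≤m)
        ; surplus-slack = λ _ → p≤q⇒p-q≤ε*p 0≤ε (0≤ℕ→ℚ (ccdh F d)) (ℕ→ℚ-mono-≤ (ℕₚ.≤-trans (ccdh≤order F d) n≤m))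
        ; deficit-slack = λ _ → deficit-via-L m (suc (Δ G)) d (ccdh F d) (L₃ m)
            (deficit-slack₃ 3≤m ℕₚ.≤-refl (Δ<order G 1≤m) 1≤d (1≤ccdh F 1≤d d≤Δ) 3≤f[1])
        }
        where
          3≤f[1] : d ≡ 1 → 3 ℕ.≤ ccdh F d
          3≤f[1] refl = subst (3 ℕ.≤_) (sym (ccdh-1 F noIsolatedF)) 3≤n

      slack-GF : ∀ {d} → 1 ℕ.≤ d → d ℕ.≤ Δ G → Slack (ccdhShape F noIsolatedF) (L₃ m - 1ℚ) d (ccdh G d)
      slack-GF {d} 1≤d d≤Δ = record
        { degree-slack  = degree-slack₃ 4≤m 1≤d (ℕₚ.≤-<-trans d≤Δ (Δ<order G 1≤m))
        ; surplus-slack = λ _ → surplus-slack₃ 4≤m 3≤n (ccdh≤order G d)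
        ; deficit-slack = λ p<n → deficit-via-L n (suc (Δ F)) d (ccdh G d) (L₃ m)
            (deficit-slack₃ 3≤m n≤m (ℕₚ.≤-trans (Δ<order F 1≤n) n≤m) 1≤d (1≤ccdh G 1≤d d≤Δ) (d≢1 p<n))
        }
        where
          d≢1 : ccdh G d ℕ.< n → d ≡ 1 → 3 ℕ.≤ ccdh G d
          d≢1 p<n refl = ⊥-elim (ℕₚ.<⇒≱ p<n (subst (n ℕ.≤_) (sym (ccdh-1 G noIsolatedG)) n≤m))

  -- Lower bounds

  module _ (m : ℕ) {y : ℚ} (0≤y : 0ℚ ≤ y) where

    φ-complete-flat : suc (suc ⌊ y ⌋ₙ) ℕ.≤ m → φ (complete m) y ≡ ℕ→ℚ m
    φ-complete-flat i+2≤m = begin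
      φ (complete m) y
        ≡⟨ φ≡chord-⌊⌋ₙ (complete m) y ⟩
      chord (ccdh (complete m)) ⌊ y ⌋ₙ y
        ≡⟨ cong₂ (λ u v → ((1ℚ + ℕ→ℚ ⌊ y ⌋ₙ) - y) * ℕ→ℚ u + (y - ℕ→ℚ ⌊ y ⌋ₙ) * ℕ→ℚ v)
                 (ccdh-complete-below (ℕₚ.≤-trans (ℕₚ.n≤1+n (suc ⌊ y ⌋ₙ)) i+2≤m)) (ccdh-complete-below i+2≤m) ⟩
      ((1ℚ + ℕ→ℚ ⌊ y ⌋ₙ) - y) * ℕ→ℚ m + (y - ℕ→ℚ ⌊ y ⌋ₙ) * ℕ→ℚ m
        ≡⟨ solve 3 (λ I y M → ((con 1ℚ :+ I) :- y) :* M :+ (y :- I) :* M := M) refl (ℕ→ℚ ⌊ y ⌋ₙ) y (ℕ→ℚ m) ⟩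
      ℕ→ℚ m ∎
      where open ≡-Reasoning

    φ-complete-last : suc ⌊ y ⌋ₙ ≡ m → φ (complete m) y ≡ ℕ→ℚ m * (ℕ→ℚ m - y)
    φ-complete-last ⌊y⌋+1≡m = begin
      φ (complete m) y
        ≡⟨ φ≡chord-⌊⌋ₙ (complete m) y ⟩
      chord (ccdh (complete m)) ⌊ y ⌋ₙ y
        ≡⟨ cong₂ (λ u v → ((1ℚ + ℕ→ℚ ⌊ y ⌋ₙ) - y) * ℕ→ℚ u + (y - ℕ→ℚ ⌊ y ⌋ₙ) * ℕ→ℚ v)
                 (ccdh-complete-below (ℕₚ.≤-reflexive ⌊y⌋+1≡m)) (ccdh-complete-above (ℕₚ.≤-reflexive (sym ⌊y⌋+1≡m))) ⟩
      ((1ℚ + ℕ→ℚ ⌊ y ⌋ₙ) - y) * ℕ→ℚ m + (y - ℕ→ℚ ⌊ y ⌋ₙ) * 0ℚ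
        ≡⟨ cong (λ u → (u - y) * ℕ→ℚ m + (y - ℕ→ℚ ⌊ y ⌋ₙ) * 0ℚ) (trans (sym (ℕ→ℚ-suc ⌊ y ⌋ₙ)) (cong ℕ→ℚ ⌊y⌋+1≡m)) ⟩
      (ℕ→ℚ m - y) * ℕ→ℚ m + (y - ℕ→ℚ ⌊ y ⌋ₙ) * 0ℚ
        ≡⟨ solve 3 (λ M y I → (M :- y) :* M :+ (y :- I) :* con 0ℚ := M :* (M :- y)) refl (ℕ→ℚ m) y (ℕ→ℚ ⌊ y ⌋ₙ) ⟩
      ℕ→ℚ m * (ℕ→ℚ m - y) ∎
      where open ≡-Reasoning

    m*[m-y]≤φ-complete : m ℕ.≤ suc ⌊ y ⌋ₙ → ℕ→ℚ m * (ℕ→ℚ m - y) ≤ φ (complete m) y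
    m*[m-y]≤φ-complete m≤⌊y⌋+1 = by-cases (m ℕ.≤? ⌊ y ⌋ₙ)
      where
        by-cases : Dec (m ℕ.≤ ⌊ y ⌋ₙ) → ℕ→ℚ m * (ℕ→ℚ m - y) ≤ φ (complete m) y
        by-cases (yes m≤⌊y⌋) = ℚₚ.≤-trans
          (ℚₚ.≤-trans (ℚₚ.*-monoˡ-≤-nonNeg (ℕ→ℚ m) {{ℚ.nonNegative (0≤ℕ→ℚ m)}}
                        (p≤q⇒p-q≤0 (ℚₚ.≤-trans (ℕ→ℚ-mono-≤ m≤⌊y⌋) (⌊x⌋ₙ≤x 0≤y))))
                      (ℚₚ.≤-reflexive (ℚₚ.*-zeroʳ (ℕ→ℚ m))))
          (ℚₚ.≤-trans (0≤ℕ→ℚ (ccdh (complete m) (suc ⌊ y ⌋ₙ))) (ccdh[⌊y⌋+1]≤φ (complete m) 0≤y))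
        by-cases (no m≰⌊y⌋) = ℚₚ.≤-reflexive (sym (φ-complete-last (ℕₚ.≤-antisym (ℕₚ.≰⇒> m≰⌊y⌋) m≤⌊y⌋+1)))

  -- φ_G(y) ≥ m (m - y) on the last piece and y ≤ 2 (1 + ε) together force m² ≤ (1 + ε)(2m + 1).
  m*m≤[1+ε]*[2m+1] : ∀ m {ε y} → 0ℚ ≤ y → m ℕ.≤ suc ⌊ y ⌋ₙ → φ (complete m) y - 1ℚ ≤ ε → y - ℕ→ℚ 2 ≤ ε * ℕ→ℚ 2 →
    ℕ→ℚ m * ℕ→ℚ m ≤ (1ℚ + ε) * ℕ→ℚ (suc (2 ℕ.* m))
  m*m≤[1+ε]*[2m+1] m {ε} {y} 0≤y m≤⌊y⌋+1 φ-1≤ε y-2≤2ε = ≤-byDifference (S + ℕ→ℚ m * R) (begin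
    (1ℚ + ε) * ℕ→ℚ (suc (2 ℕ.* m)) - ℕ→ℚ m * ℕ→ℚ m
      ≡⟨ cong (λ z → (1ℚ + ε) * z - ℕ→ℚ m * ℕ→ℚ m) ([2m+1]≡1+[m+m] m) ⟩
    (1ℚ + ε) * (1ℚ + (ℕ→ℚ m + ℕ→ℚ m)) - ℕ→ℚ m * ℕ→ℚ m
      ≡⟨ solve 3 (λ M e y → (con 1ℚ :+ e) :* (con 1ℚ :+ (M :+ M)) :- M :* M
                            := ((con 1ℚ :+ e) :- M :* (M :- y)) :+ M :* ((con (ℕ→ℚ 2) :+ e :* con (ℕ→ℚ 2)) :- y)) refl (ℕ→ℚ m) ε y ⟩
    S + ℕ→ℚ m * R ∎)
    (0≤+ 0≤S (0≤* (0≤ℕ→ℚ m) 0≤R))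
    where
      open ≡-Reasoning
      S = (1ℚ + ε) - ℕ→ℚ m * (ℕ→ℚ m - y)
      R = (ℕ→ℚ 2 + ε * ℕ→ℚ 2) - y
      φ≤1+ε : φ (complete m) y ≤ 1ℚ + ε
      φ≤1+ε = ≤-byDifference (ε - (φ (complete m) y - 1ℚ))
        (solve 2 (λ e f → (con 1ℚ :+ e) :- f := e :- (f :- con 1ℚ)) refl ε (φ (complete m) y))
        (p≤q⇒0≤q-p φ-1≤ε)
      0≤S : 0ℚ ≤ S
      0≤S = p≤q⇒0≤q-p {ℕ→ℚ m * (ℕ→ℚ m - y)} {1ℚ + ε} (ℚₚ.≤-trans (m*[m-y]≤φ-complete m 0≤y m≤⌊y⌋+1) φ≤1+ε)
      R≡ : ε * ℕ→ℚ 2 - (y - ℕ→ℚ 2) ≡ R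
      R≡ = solve 2 (λ e y → e :* con (ℕ→ℚ 2) :- (y :- con (ℕ→ℚ 2)) := (con (ℕ→ℚ 2) :+ e :* con (ℕ→ℚ 2)) :- y) refl ε y
      0≤R : 0ℚ ≤ R
      0≤R = subst (0ℚ ≤_) R≡ (p≤q⇒0≤q-p y-2≤2ε)

  rh-lower₂ : ∀ {m} → 2 ℕ.≤ m → ∀ {ε} → ε < L₂ m - 1ℚ → ¬ RHLe (star 1) (complete m) ε
  rh-lower₂ {m} 2≤m {ε} ε<ε₂ ((_ , forward) , _) = refute (forward 1 (s≤s z≤n) 1≤Δ)
    where
      1≤Δ : 1 ℕ.≤ Δ (star 1)
      1≤Δ = ℕₚ.≤-trans (ℕₚ.≤-reflexive (sym (deg-star-centre 1))) (deg≤Δ (star 1) Fin.zero)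
      φF[1]≡2 : φ (star 1) (ℕ→ℚ 1) ≡ ℕ→ℚ 2
      φF[1]≡2 = trans (φ-ℕ (star 1) 1) (cong ℕ→ℚ (ccdh-1 (star 1) (star-noIsolated 0)))
      ε*2<m-2 : ε * ℕ→ℚ 2 < ℕ→ℚ m - ℕ→ℚ 2
      ε*2<m-2 = ℚₚ.<-≤-trans (ℚₚ.*-monoˡ-<-pos (ℕ→ℚ 2) ε<ε₂) (ℚₚ.≤-reflexive ([L₂-1]*2≡m-2 m))
      refute : (∃ λ d' → 1ℚ ≤ d' × d' ≤ ℕ→ℚ (suc (Δ (complete m))) × ∣ ℕ→ℚ 1 - d' ∣ ≤ ε * ℕ→ℚ 1 ×
                 ∣ φ (star 1) (ℕ→ℚ 1) - φ (complete m) d' ∣ ≤ ε * φ (star 1) (ℕ→ℚ 1)) → ⊥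
      refute (d' , 1≤d' , _ , close-d , close-φ) = by-cases (suc (suc ⌊ d' ⌋ₙ) ℕ.≤? m)
        where
          0≤d' = ℚₚ.≤-trans (0≤ℕ→ℚ 1) 1≤d'
          by-cases : Dec (suc (suc ⌊ d' ⌋ₙ) ℕ.≤ m) → ⊥
          by-cases (yes flat) = <⇒≱ ε*2<m-2 (subst₂ (λ u v → u - v ≤ ε * v) (φ-complete-flat m 0≤d' flat) φF[1]≡2
                                              (∣p-q∣≤r⇒q-p≤r (φ (star 1) (ℕ→ℚ 1)) (φ (complete m) d') close-φ))
          by-cases (no steep) = <⇒≱ (ℚₚ.<-≤-trans ε<ε₂ (L₂-1≤m-2 2≤m)) (begin
            ℕ→ℚ m - ℕ→ℚ 2        ≤⟨ ℚₚ.+-monoˡ-≤ (- ℕ→ℚ 2) m≤1+d' ⟩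
            (1ℚ + d') - ℕ→ℚ 2    ≡⟨ solve 1 (λ d → (con 1ℚ :+ d) :- con (ℕ→ℚ 2) := d :- con 1ℚ) refl d' ⟩
            d' - 1ℚ              ≤⟨ ∣p-q∣≤r⇒q-p≤r (ℕ→ℚ 1) d' close-d ⟩
            ε * 1ℚ               ≡⟨ ℚₚ.*-identityʳ ε ⟩
            ε                    ∎)
            where
              open ℚₚ.≤-Reasoning
              m≤1+d' : ℕ→ℚ m ≤ 1ℚ + d'
              m≤1+d' = ℚₚ.≤-trans (ℕ→ℚ-mono-≤ (ℕₚ.≤-pred (ℕₚ.≰⇒> steep)))
                         (subst (_≤ 1ℚ + d') (sym (ℕ→ℚ-suc ⌊ d' ⌋ₙ)) (ℚₚ.+-monoʳ-≤ 1ℚ (⌊x⌋ₙ≤x 0≤d')))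

  rh-lower₃ : ∀ k {m} → 4 ℕ.≤ m → ∀ {ε} → ε < L₃ m - 1ℚ → ¬ RHLe (star (suc (suc k))) (complete m) ε
  rh-lower₃ k {m} 4≤m {ε} ε<ε₃ ((_ , forward) , _) = refute (forward 2 (s≤s z≤n) (2≤Δ-star k))
    where
      φF[2]≡1 : φ (star (suc (suc k))) (ℕ→ℚ 2) ≡ 1ℚ
      φF[2]≡1 = trans (φ-ℕ (star (suc (suc k))) 2) (cong ℕ→ℚ (ccdh-star-2 k))
      [1+ε]*[2m+1]<m*m : (1ℚ + ε) * ℕ→ℚ (suc (2 ℕ.* m)) < ℕ→ℚ m * ℕ→ℚ m
      [1+ε]*[2m+1]<m*m = ℚₚ.<-≤-trans
        (ℚₚ.*-monoˡ-<-pos (ℕ→ℚ (suc (2 ℕ.* m))) {{ℚ.positive (0<ℕ→ℚ-suc (2 ℕ.* m))}}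
          (subst (1ℚ + ε <_) (1+[L-1]≡L (L₃ m)) (ℚₚ.+-monoʳ-< 1ℚ ε<ε₃)))
        (ℚₚ.≤-reflexive (L₃*[2m+1]≡m*m m))
      refute : (∃ λ d' → 1ℚ ≤ d' × d' ≤ ℕ→ℚ (suc (Δ (complete m))) × ∣ ℕ→ℚ 2 - d' ∣ ≤ ε * ℕ→ℚ 2 ×
                 ∣ φ (star (suc (suc k))) (ℕ→ℚ 2) - φ (complete m) d' ∣ ≤ ε * φ (star (suc (suc k))) (ℕ→ℚ 2)) → ⊥
      refute (d' , 1≤d' , _ , close-d , close-φ) = by-cases (suc (suc ⌊ d' ⌋ₙ) ℕ.≤? m)
        where
          0≤d' = ℚₚ.≤-trans (0≤ℕ→ℚ 1) 1≤d'
          φG-1≤ε : φ (complete m) d' - 1ℚ ≤ ε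
          φG-1≤ε = subst₂ (λ u v → φ (complete m) d' - u ≤ v) φF[2]≡1 (trans (cong (ε *_) φF[2]≡1) (ℚₚ.*-identityʳ ε))
                     (∣p-q∣≤r⇒q-p≤r (φ (star (suc (suc k))) (ℕ→ℚ 2)) (φ (complete m) d') close-φ)
          by-cases : Dec (suc (suc ⌊ d' ⌋ₙ) ℕ.≤ m) → ⊥
          by-cases (yes flat) = <⇒≱ (ℚₚ.<-≤-trans ε<ε₃ (ℚₚ.+-monoˡ-≤ (- 1ℚ) (L₃≤m m)))
            (subst (λ z → z - 1ℚ ≤ ε) (φ-complete-flat m 0≤d' flat) φG-1≤ε)
          by-cases (no steep) = <⇒≱ [1+ε]*[2m+1]<m*m
            (m*m≤[1+ε]*[2m+1] m 0≤d' (ℕₚ.≤-pred (ℕₚ.≰⇒> steep)) φG-1≤ε (∣p-q∣≤r⇒q-p≤r (ℕ→ℚ 2) d' close-d))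

  maxRH₂ : ∀ {m} → 2 ℕ.≤ m → MaxRHIs 2 m (L₂ m - 1ℚ)
  maxRH₂ {m} 2≤m = (λ F G → rh-bound₂ 2≤m F G) ,
    (star 1 , complete m , star-noIsolated 0 , complete-noIsolated 2≤m ,
     rh-bound₂ 2≤m (star 1) (complete m) (star-noIsolated 0) (complete-noIsolated 2≤m) , λ ε → rh-lower₂ 2≤m)

  maxRH₃ : ∀ {n m} → 3 ℕ.≤ n → n ℕ.≤ m → 4 ℕ.≤ m → MaxRHIs n m (L₃ m - 1ℚ)
  maxRH₃ {0} () _ _
  maxRH₃ {1} (s≤s ()) _ _
  maxRH₃ {2} (s≤s (s≤s ())) _ _
  maxRH₃ {suc (suc (suc k))} {m} 3≤n n≤m 4≤m = (λ F G → rh-bound₃ 3≤n n≤m 4≤m F G) ,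
    (star (suc (suc k)) , complete m , star-noIsolated (suc k) , complete-noIsolated 2≤m ,
     rh-bound₃ 3≤n n≤m 4≤m (star (suc (suc k))) (complete m) (star-noIsolated (suc k)) (complete-noIsolated 2≤m) ,
     λ ε → rh-lower₃ k 4≤m)
    where
      2≤m = ℕₚ.≤-trans (s≤s (s≤s z≤n)) 4≤m

-- Opened only here: ℕ's _≤_ and _*_ would clash with ℚ's inside RelativeHausdorff.
open import Data.Nat using (ℕ; suc; _≤_; _*_; _+_)
open import Data.Integer using (+_)
open import Data.Rational using (ℚ; _/_; _-_; 1ℚ)
open import Data.Product using (_×_; _,_)
open import Relation.Binary.PropositionalEquality using (_≡_; refl)

open import Defs using (MaxRHIs)
open RelativeHausdorff using (maxRH₂; maxRH₃)

theorem5p1 : ∀ (n m : ℕ) → 2 ≤ n → n ≤ m →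
    (n ≡ 2 → MaxRHIs n m ((+ m / 2) - 1ℚ)) ×
    (3 ≤ n → 4 ≤ m → MaxRHIs n m ((+ (m * m) / suc (2 * m)) - 1ℚ))
theorem5p1 n m 2≤n n≤m = (λ { refl → maxRH₂ n≤m }) , λ 3≤n 4≤m → maxRH₃ 3≤n n≤m 4≤m
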